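{- Every $3$-regular (cubic) finite simple graph without bridges is a proper color-line graph.
   Context: An edge coloring $\phi$ of a graph $H$ is proper if any two distinct edges sharing an endvertex get different colors. For an edge-colored graph $(H,\phi)$, the color-line graph $\mathrm{CL}(H)$ has vertex set $E(H)$, two distinct vertices being adjacent iff the corresponding edges of $H$ share an endvertex or have the same color. $G$ is a proper color-line graph if $G\cong\mathrm{CL}(H)$ for some graph $H$ with a proper edge coloring. -}

module Defs where

open import Data.Nat using (ℕ)
open import Data.Bool using (Bool; true; false; if_then_else_)
open import Data.Fin using (Fin; _<_)
open import Data.List using (List; map; allFin)
open import Data.Nat.ListAction using (sum)
open import Data.Product using (Σ; _×_; _,_; proj₁; proj₂; ∃)
open import Data.Sum using (_⊎_)
open import Relation.Nullary using (¬_)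
open import Relation.Binary.PropositionalEquality using (_≡_; _≢_)
open import Relation.Binary.Construct.Closure.ReflexiveTransitive using (Star)
open import Function.Bundles using (_⤖_; _⇔_; Bijection)

record SimpleGraph (n : ℕ) : Set where
  field
    adj   : Fin n → Fin n → Bool
    sym   : ∀ u v → adj u v ≡ adj v u
    irref : ∀ v → adj v v ≡ false
open SimpleGraph public

degree : ∀ {n} → SimpleGraph n → Fin n → ℕ
degree {n} G v = sum (map (λ w → if adj G v w then 1 else 0) (allFin n))

Cubic : ∀ {n} → SimpleGraph n → Set
Cubic G = ∀ v → degree G v ≡ 3

AdjMinus : ∀ {n} → SimpleGraph n → Fin n → Fin n → Fin n → Fin n → Set
AdjMinus G u v x y = (adj G x y ≡ true) × ¬ (x ≡ u × y ≡ v) × ¬ (x ≡ v × y ≡ u)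

IsBridge : ∀ {n} → SimpleGraph n → Fin n → Fin n → Set
IsBridge G u v = (adj G u v ≡ true) × ¬ Star (AdjMinus G u v) u v

Bridgeless : ∀ {n} → SimpleGraph n → Set
Bridgeless G = ∀ u v → ¬ IsBridge G u v

Edge : ∀ {m} → SimpleGraph m → Set
Edge {m} H = Σ (Fin m × Fin m) λ p → (proj₁ p < Data.Product.proj₂ p) × (adj H (proj₁ p) (Data.Product.proj₂ p) ≡ true)

endpoints : ∀ {m} {H : SimpleGraph m} → Edge H → Fin m × Fin m
endpoints = proj₁

ShareEnd : ∀ {m} {H : SimpleGraph m} → Edge H → Edge H → Set
ShareEnd e f =
  let a = proj₁ (proj₁ e) ; b = proj₂ (proj₁ e) ; c = proj₁ (proj₁ f) ; d = proj₂ (proj₁ f)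
  in (a ≡ c ⊎ a ≡ d) ⊎ (b ≡ c ⊎ b ≡ d)

DistinctEdges : ∀ {m} {H : SimpleGraph m} → Edge H → Edge H → Set
DistinctEdges {H = H} e f = endpoints {H = H} e ≢ endpoints {H = H} f

ProperColoring : ∀ {m} (H : SimpleGraph m) → (Edge H → ℕ) → Set
ProperColoring H φ = ∀ e f → DistinctEdges {H = H} e f → ShareEnd {H = H} e f → φ e ≢ φ f

CLAdj : ∀ {m} (H : SimpleGraph m) → (Edge H → ℕ) → Edge H → Edge H → Set
CLAdj H φ e f = DistinctEdges {H = H} e f × (ShareEnd {H = H} e f ⊎ φ e ≡ φ f)

-- G is a proper colour-line graph: there is a finite simple graph H with a
-- proper edge colouring φ and an isomorphism σ : V(G) → E(H) = V(CL(H))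
IsProperColorLineGraph : ∀ {n} → SimpleGraph n → Set
IsProperColorLineGraph {n} G =
  Σ ℕ λ m → Σ (SimpleGraph m) λ H → Σ (Edge H → ℕ) λ φ →
    ProperColoring H φ ×
    Σ (Fin n ⤖ Edge H) λ σ →
      ∀ i j → (adj G i j ≡ true) ⇔ CLAdj H φ (Bijection.to σ i) (Bijection.to σ j)

-- Petersen's theorem: a bridgeless cubic graph G has a perfect matching M.  Following
-- Lovász's proof of Tutte's theorem we show that every spanning supergraph K of G has one,
-- by induction on the number of non-edges of K.  If K has an induced path a–b–c whose
-- middle vertex b misses some vertex d, then K + ac and K + bd have perfect matchings M₁
-- and M₂ by induction, and an alternating walk of M₁ and M₂ starting at d shows how to
-- combine them into one of K.  Otherwise the non-universal vertices of K fall into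
-- cliques.  Since G is cubic, a clique of odd size sends an odd number of G-edges to the
-- set U of universal vertices, and since G is bridgeless this number is not 1; so it is
-- at least 3, and counting G-edges into U shows there are at most |U| odd cliques.  A
-- greedy matching then pairs the vertices inside cliques, the leftover vertex of each odd
-- clique with a vertex of U, and the remaining vertices of U among themselves.
--
-- The colour-line graph: G − M is 2-regular.  Let H have the edges of G − M as vertices,
-- and let each vertex x of G become the edge of H joining the two edges of G − M at x,
-- coloured by the edge of M at x.  Then two vertices of G are joined by an edge of G − M
-- iff their edges in H share an endvertex, and by an edge of M iff they have the same
-- colour; this colouring is proper because M and G − M are disjoint.

module Submission where

open import Defs hiding (sym)
open import Data.Nat
open import Data.Nat.Properties
open import Data.Nat.Induction using (<-rec; <-wellFounded)
import Data.Nat.ListAction as List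
open import Data.Bool using (Bool; true; false; not; _∧_; _∨_; _xor_; if_then_else_)
import Data.Bool.Properties as BP
open import Data.Fin using (Fin; zero; suc; toℕ; combine)
import Data.Fin.Properties as FP
open import Data.List using (map; allFin; tabulate)
open import Data.List.Properties using (map-tabulate)
open import Data.Product using (Σ; _×_; _,_; proj₁; proj₂; ∃)
open import Data.Sum using (_⊎_; inj₁; inj₂)
open import Data.Empty using (⊥; ⊥-elim)
open import Relation.Nullary using (¬_; Dec; yes; no; does; ¬?)
open import Relation.Nullary.Decidable
  using (decidable-stable; _⊎-dec_; _×-dec_; _→-dec_; dec-true; dec-false; does-⇔)
open import Relation.Unary using (Decidable)
open import Relation.Binary.PropositionalEquality
open import Relation.Binary.Definitions using (tri<; tri≈; tri>)
open import Relation.Binary.Construct.Closure.ReflexiveTransitive using (Star; ε; _◅_)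
import Relation.Binary.Construct.On as On
open import Induction.WellFounded using (module All)
open import Level using (0ℓ)
open import Function using (_∘_)
open import Function.Bundles using (_⤖_; _⇔_; mk⤖; mk⇔)
import Axiom.UniquenessOfIdentityProofs as UIP
open import Algebra.Bundles using (CommutativeMonoid)
open import Algebra.Properties.Semiring.Sum +-*-semiring
  using (sum; sum-cong-≗; ∑-distrib-+; ∑-comm; *-distribˡ-sum; *-distribʳ-sum; sum-replicate-zero)
open import Algebra.Properties.CommutativeSemigroup +-commutativeSemigroup using (interchange)
open import Algebra.Properties.CommutativeSemigroup (CommutativeMonoid.commutativeSemigroup BP.∧-commutativeMonoid)
  using () renaming (x∙yz≈y∙xz to ∧-swap)

module _ {A : Set} where

  does-true⇒ : (a? : Dec A) → does a? ≡ true → A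
  does-true⇒ (yes a) _ = a

  does-false⇒ : (a? : Dec A) → does a? ≡ false → ¬ A
  does-false⇒ (no ¬a) _ = ¬a

∧≡true : ∀ {a b} → a ∧ b ≡ true → a ≡ true × b ≡ true
∧≡true {true} {true} _ = refl , refl

_≟ᵇ_ : ∀ {n} → Fin n → Fin n → Bool
x ≟ᵇ y = does (x FP.≟ y)

≟ᵇ-refl : ∀ {n} (x : Fin n) → (x ≟ᵇ x) ≡ true
≟ᵇ-refl x = dec-true (x FP.≟ x) refl

≟ᵇ-≢ : ∀ {n} {x y : Fin n} → x ≢ y → (x ≟ᵇ y) ≡ false
≟ᵇ-≢ {x = x} {y} = dec-false (x FP.≟ y)

≟ᵇ⇒≡ : ∀ {n} {x y : Fin n} → (x ≟ᵇ y) ≡ true → x ≡ y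
≟ᵇ⇒≡ {x = x} {y} = does-true⇒ (x FP.≟ y)

⟦_⟧ : Bool → ℕ
⟦ b ⟧ = if b then 1 else 0

⟦⟧≤1 : ∀ b → ⟦ b ⟧ ≤ 1
⟦⟧≤1 true  = ≤-refl
⟦⟧≤1 false = z≤n

⟦∧⟧ : ∀ a b → ⟦ a ∧ b ⟧ ≡ ⟦ a ⟧ * ⟦ b ⟧
⟦∧⟧ true  b = sym (*-identityˡ ⟦ b ⟧)
⟦∧⟧ false b = refl

0<⟦⟧⇒true : ∀ {b} → 0 < ⟦ b ⟧ → b ≡ true
0<⟦⟧⇒true {true} _ = refl

⟦⟧*⟦⟧-pos : ∀ {a b} → 0 < ⟦ a ⟧ * ⟦ b ⟧ → a ≡ true × b ≡ true
⟦⟧*⟦⟧-pos {true}  {true}  _ = refl , refl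
⟦⟧*⟦⟧-pos {true}  {false} ()
⟦⟧*⟦⟧-pos {false}         ()

sum-allFin : ∀ {n} (f : Fin n → ℕ) → List.sum (map f (allFin n)) ≡ sum f
sum-allFin {n} f = trans (cong List.sum (map-tabulate (λ i → i) f)) (sum-tabulate f)
  where
  sum-tabulate : ∀ {n} (f : Fin n → ℕ) → List.sum (tabulate f) ≡ sum f
  sum-tabulate {zero}  f = refl
  sum-tabulate {suc n} f = cong (f zero +_) (sum-tabulate (f ∘ suc))

sum-zero : ∀ {n} {f : Fin n → ℕ} → (∀ i → f i ≡ 0) → sum f ≡ 0
sum-zero {n} f≡0 = trans (sum-cong-≗ f≡0) (sum-replicate-zero n)

sum-const : ∀ n k → sum {n} (λ _ → k) ≡ n * k
sum-const zero    k = refl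
sum-const (suc n) k = cong (k +_) (sum-const n k)

sum-mono-≤ : ∀ {n} {f g : Fin n → ℕ} → (∀ i → f i ≤ g i) → sum f ≤ sum g
sum-mono-≤ {zero}  f≤g = z≤n
sum-mono-≤ {suc n} f≤g = +-mono-≤ (f≤g zero) (sum-mono-≤ (f≤g ∘ suc))

sum-mono-< : ∀ {n} {f g : Fin n → ℕ} → (∀ i → f i ≤ g i) → ∀ i → f i < g i → sum f < sum g
sum-mono-< f≤g zero    fi<gi = +-mono-<-≤ fi<gi (sum-mono-≤ (f≤g ∘ suc))
sum-mono-< f≤g (suc i) fi<gi = +-mono-≤-< (f≤g zero) (sum-mono-< (f≤g ∘ suc) i fi<gi)

term≤sum : ∀ {n} (f : Fin n → ℕ) i → f i ≤ sum f
term≤sum f zero    = m≤m+n _ _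
term≤sum f (suc i) = ≤-trans (term≤sum (f ∘ suc) i) (m≤n+m _ _)

two-terms≤sum : ∀ {n} (f : Fin n → ℕ) {i j} → i ≢ j → f i + f j ≤ sum f
two-terms≤sum f {zero}  {zero}  i≢j = ⊥-elim (i≢j refl)
two-terms≤sum f {zero}  {suc j} i≢j = +-monoʳ-≤ (f zero) (term≤sum (f ∘ suc) j)
two-terms≤sum f {suc i} {zero}  i≢j =
  subst (_≤ sum f) (+-comm (f zero) (f (suc i))) (+-monoʳ-≤ (f zero) (term≤sum (f ∘ suc) i))
two-terms≤sum f {suc i} {suc j} i≢j =
  ≤-trans (two-terms≤sum (f ∘ suc) (i≢j ∘ cong suc)) (m≤n+m _ _)

sum-pos : ∀ {n} (f : Fin n → ℕ) → 0 < sum f → ∃ λ i → 0 < f i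
sum-pos {suc n} f 0<sum with f zero in fzero≡
... | suc _ = zero , subst (0 <_) (sym fzero≡) (s≤s z≤n)
... | zero  = let i , 0<fi = sum-pos (f ∘ suc) 0<sum in suc i , 0<fi

sum≡1-unique : ∀ {n} (f : Fin n → ℕ) → sum f ≡ 1 → ∀ {i j} → 0 < f i → 0 < f j → i ≡ j
sum≡1-unique f sum≡1 {i} {j} 0<fi 0<fj with i FP.≟ j
... | yes i≡j = i≡j
... | no  i≢j = ⊥-elim (<-irrefl refl (subst (2 ≤_) sum≡1 (≤-trans (+-mono-≤ 0<fi 0<fj) (two-terms≤sum f i≢j))))

double-sum≡1-unique : ∀ {m n} (f : Fin m → Fin n → ℕ) → sum (λ i → sum (f i)) ≡ 1 →
                      ∀ {i i' j j'} → 0 < f i j → 0 < f i' j' → i ≡ i' × j ≡ j'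
double-sum≡1-unique f total≡1 {i} {i'} {j} {j'} 0<fij 0<fi'j' =
  same-row (sum≡1-unique (λ i → sum (f i)) total≡1 (row-pos 0<fij) (row-pos 0<fi'j')) 0<fi'j'
  where
  row-pos : ∀ {i j} → 0 < f i j → 0 < sum (f i)
  row-pos {i} {j} 0<fij = <-≤-trans 0<fij (term≤sum (f i) j)
  row≡1 : sum (f i) ≡ 1
  row≡1 = ≤-antisym (subst (sum (f i) ≤_) total≡1 (term≤sum (λ i → sum (f i)) i)) (row-pos 0<fij)
  same-row : ∀ {i'} → i ≡ i' → 0 < f i' j' → i ≡ i' × j ≡ j'
  same-row refl 0<fij' = refl , sum≡1-unique (f i) row≡1 0<fij 0<fij'

sum-update : ∀ {n} (f g : Fin n → ℕ) j → (∀ i → i ≢ j → f i ≡ g i) → sum f + g j ≡ sum g + f j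
sum-update {suc n} f g zero f≡g = begin
  f zero + sum (f ∘ suc) + g zero   ≡⟨ cong (λ s → f zero + s + g zero) (sum-cong-≗ (λ i → f≡g (suc i) λ ())) ⟩
  f zero + sum (g ∘ suc) + g zero   ≡⟨ +-comm (f zero + _) (g zero) ⟩
  g zero + (f zero + sum (g ∘ suc)) ≡⟨ cong (g zero +_) (+-comm (f zero) _) ⟩
  g zero + (sum (g ∘ suc) + f zero) ≡⟨ +-assoc (g zero) _ _ ⟨
  g zero + sum (g ∘ suc) + f zero   ∎
  where open ≡-Reasoning
sum-update {suc n} f g (suc j) f≡g = begin
  f zero + sum (f ∘ suc) + g (suc j)   ≡⟨ +-assoc (f zero) _ _ ⟩
  f zero + (sum (f ∘ suc) + g (suc j)) ≡⟨ cong₂ _+_ (f≡g zero λ ()) (sum-update (f ∘ suc) (g ∘ suc) j f≡g-suc) ⟩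
  g zero + (sum (g ∘ suc) + f (suc j)) ≡⟨ +-assoc (g zero) _ _ ⟨
  g zero + sum (g ∘ suc) + f (suc j)   ∎
  where
  open ≡-Reasoning
  f≡g-suc : ∀ i → i ≢ j → f (suc i) ≡ g (suc i)
  f≡g-suc i i≢j = f≡g (suc i) (i≢j ∘ FP.suc-injective)

sum-update₂ : ∀ {n} (f g : Fin n → ℕ) {i j} → i ≢ j → (∀ k → k ≢ i → k ≢ j → f k ≡ g k) →
              sum f + (g i + g j) ≡ sum g + (f i + f j)
sum-update₂ {n} f g {i} {j} i≢j f≡g = begin
  sum f + (g i + g j)   ≡⟨ +-assoc (sum f) (g i) (g j) ⟨
  sum f + g i + g j     ≡⟨ cong (λ t → sum f + t + g j) h-i ⟨
  sum f + h i + g j     ≡⟨ cong (_+ g j) (sum-update f h i λ k k≢i → sym (h-other k≢i)) ⟩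
  sum h + f i + g j     ≡⟨ +-assoc (sum h) (f i) (g j) ⟩
  sum h + (f i + g j)   ≡⟨ cong (sum h +_) (+-comm (f i) (g j)) ⟩
  sum h + (g j + f i)   ≡⟨ +-assoc (sum h) (g j) (f i) ⟨
  sum h + g j + f i     ≡⟨ cong (_+ f i) (sum-update h g j h≡g) ⟩
  sum g + h j + f i     ≡⟨ cong (λ t → sum g + t + f i) (h-other (i≢j ∘ sym)) ⟩
  sum g + f j + f i     ≡⟨ +-assoc (sum g) (f j) (f i) ⟩
  sum g + (f j + f i)   ≡⟨ cong (sum g +_) (+-comm (f j) (f i)) ⟩
  sum g + (f i + f j)   ∎
  where
  open ≡-Reasoning
  h : Fin n → ℕ
  h k with k FP.≟ i
  ... | yes _ = g i
  ... | no  _ = f k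
  h-other : ∀ {k} → k ≢ i → h k ≡ f k
  h-other {k} k≢i with k FP.≟ i
  ... | yes k≡i = ⊥-elim (k≢i k≡i)
  ... | no  _   = refl
  h-i : h i ≡ g i
  h-i with i FP.≟ i
  ... | yes _   = refl
  ... | no  i≢i = ⊥-elim (i≢i refl)
  h≡g : ∀ k → k ≢ j → h k ≡ g k
  h≡g k k≢j with k FP.≟ i
  ... | yes refl = refl
  ... | no  k≢i  = f≡g k k≢i k≢j

sum-single : ∀ {n} (f : Fin n → ℕ) i → (∀ j → j ≢ i → f j ≡ 0) → sum f ≡ f i
sum-single {n} f i others≡0 = begin
  sum f                   ≡⟨ +-identityʳ (sum f) ⟨
  sum f + 0               ≡⟨ sum-update f (λ _ → 0) i others≡0 ⟩
  sum {n} (λ _ → 0) + f i ≡⟨ cong (_+ f i) (sum-zero {n} λ _ → refl) ⟩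
  f i                     ∎
  where open ≡-Reasoning

count : ∀ {n} → (Fin n → Bool) → ℕ
count P = sum λ i → ⟦ P i ⟧

count-pos : ∀ {n} (P : Fin n → Bool) → 0 < count P → ∃ λ i → P i ≡ true
count-pos P 0<count = let i , 0<Pi = sum-pos (λ i → ⟦ P i ⟧) 0<count in i , 0<⟦⟧⇒true 0<Pi

count≡1-unique : ∀ {n} (P : Fin n → Bool) → count P ≡ 1 → ∀ {i j} → P i ≡ true → P j ≡ true → i ≡ j
count≡1-unique P count≡1 Pi Pj = sum≡1-unique (λ i → ⟦ P i ⟧) count≡1 (pos Pi) (pos Pj)
  where
  pos : ∀ {i} → P i ≡ true → 0 < ⟦ P i ⟧
  pos Pi rewrite Pi = s≤s z≤n

_-_ : ∀ {n} → (Fin n → Bool) → Fin n → Fin n → Bool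
(P - x) z = P z ∧ not (z ≟ᵇ x)

count-remove : ∀ {n} (P : Fin n → Bool) {x} → P x ≡ true → count P ≡ suc (count (P - x))
count-remove P {x} Px = begin
  count P                   ≡⟨ +-identityʳ (count P) ⟨
  count P + 0               ≡⟨ cong (count P +_) x-removed ⟨
  count P + ⟦ (P - x) x ⟧   ≡⟨ sum-update (λ z → ⟦ P z ⟧) (λ z → ⟦ (P - x) z ⟧) x kept ⟩
  count (P - x) + ⟦ P x ⟧   ≡⟨ cong (λ b → count (P - x) + ⟦ b ⟧) Px ⟩
  count (P - x) + 1         ≡⟨ +-comm (count (P - x)) 1 ⟩
  suc (count (P - x))       ∎
  where
  open ≡-Reasoning
  x-removed : ⟦ (P - x) x ⟧ ≡ 0
  x-removed = cong ⟦_⟧ (trans (cong (λ b → P x ∧ not b) (≟ᵇ-refl x)) (BP.∧-zeroʳ (P x)))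
  kept : ∀ z → z ≢ x → ⟦ P z ⟧ ≡ ⟦ (P - x) z ⟧
  kept z z≢x = cong ⟦_⟧ (sym (trans (cong (λ b → P z ∧ not b) (≟ᵇ-≢ z≢x)) (BP.∧-identityʳ (P z))))

remove-elim : ∀ {n} (P : Fin n → Bool) {x z} → (P - x) z ≡ true → P z ≡ true × z ≢ x
remove-elim P {x} {z} Pz with P z | z FP.≟ x
... | true | no z≢x = refl , z≢x

remove-intro : ∀ {n} (P : Fin n → Bool) {x z} → P z ≡ true → z ≢ x → (P - x) z ≡ true
remove-intro P {x} {z} Pz z≢x rewrite Pz | ≟ᵇ-≢ z≢x = refl

record TwoOthers {n} (P : Fin n → Bool) (x₀ : Fin n) : Set where
  field
    y₁ y₂ : Fin n
    P-y₁  : P y₁ ≡ true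
    P-y₂  : P y₂ ≡ true
    y₁≢x₀ : y₁ ≢ x₀
    y₂≢x₀ : y₂ ≢ x₀
    y₁≢y₂ : y₁ ≢ y₂
    only  : ∀ {z} → P z ≡ true → z ≡ x₀ ⊎ z ≡ y₁ ⊎ z ≡ y₂

count≡3⇒twoOthers : ∀ {n} (P : Fin n → Bool) {x} → P x ≡ true → count P ≡ 3 → TwoOthers P x
count≡3⇒twoOthers P {x} Px count≡3 = pick₁ (count-pos (P - x) (subst (0 <_) (sym count₂) (s≤s z≤n)))
  where
  count₂ : count (P - x) ≡ 2
  count₂ = suc-injective (trans (sym (count-remove P Px)) count≡3)
  pick₁ : (∃ λ y₁ → (P - x) y₁ ≡ true) → TwoOthers P x
  pick₁ (y₁ , P'y₁) = pick₂ (count-pos ((P - x) - y₁) (subst (0 <_) (sym count₁) (s≤s z≤n)))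
    where
    count₁ : count ((P - x) - y₁) ≡ 1
    count₁ = suc-injective (trans (sym (count-remove (P - x) P'y₁)) count₂)
    pick₂ : (∃ λ y₂ → ((P - x) - y₁) y₂ ≡ true) → TwoOthers P x
    pick₂ (y₂ , P''y₂) = record
      { y₁ = y₁ ; y₂ = y₂
      ; P-y₁ = proj₁ (remove-elim P P'y₁) ; P-y₂ = proj₁ (remove-elim P P'y₂)
      ; y₁≢x₀ = proj₂ (remove-elim P P'y₁) ; y₂≢x₀ = proj₂ (remove-elim P P'y₂)
      ; y₁≢y₂ = proj₂ (remove-elim (P - x) P''y₂) ∘ sym
      ; only = only }
      where
      P'y₂ : (P - x) y₂ ≡ true
      P'y₂ = proj₁ (remove-elim (P - x) P''y₂)
      only : ∀ {z} → P z ≡ true → z ≡ x ⊎ z ≡ y₁ ⊎ z ≡ y₂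
      only {z} Pz with z FP.≟ x | z FP.≟ y₁
      ... | yes z≡x | _        = inj₁ z≡x
      ... | no _    | yes z≡y₁ = inj₂ (inj₁ z≡y₁)
      ... | no z≢x  | no z≢y₁  =
        inj₂ (inj₂ (count≡1-unique ((P - x) - y₁) count₁ (remove-intro (P - x) (remove-intro P Pz z≢x) z≢y₁) P''y₂))

odd : ℕ → Bool
odd zero    = false
odd (suc n) = not (odd n)

odd-+ : ∀ m n → odd (m + n) ≡ odd m xor odd n
odd-+ zero    n = refl
odd-+ (suc m) n = trans (cong not (odd-+ m n)) (BP.not-distribˡ-xor (odd m) (odd n))

odd-double : ∀ m → odd (m + m) ≡ false
odd-double m = trans (odd-+ m m) (BP.xor-same (odd m))

odd-+-double : ∀ m k → odd (m + (k + k)) ≡ odd m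
odd-+-double m k = trans (odd-+ m (k + k)) (trans (cong (odd m xor_) (odd-double k)) (BP.xor-identityʳ (odd m)))

odd-*3 : ∀ k → odd (k * 3) ≡ odd k
odd-*3 k = begin
  odd (k * 3)           ≡⟨ cong odd (*-comm k 3) ⟩
  odd (k + (k + (k + 0))) ≡⟨ cong (λ t → odd (k + (k + t))) (+-identityʳ k) ⟩
  odd (k + (k + k))     ≡⟨ odd-+-double k k ⟩
  odd k                 ∎
  where open ≡-Reasoning

odd∧≢1⇒≥3 : ∀ s → odd s ≡ true → s ≢ 1 → 3 ≤ s
odd∧≢1⇒≥3 (suc zero)          _ s≢1 = ⊥-elim (s≢1 refl)
odd∧≢1⇒≥3 (suc (suc (suc s))) _ _   = s≤s (s≤s (s≤s z≤n))

symmetric-double-sum-even : ∀ {n} (h : Fin n → Fin n → ℕ) →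
  (∀ i j → h i j ≡ h j i) → (∀ i → h i i ≡ 0) → odd (sum λ i → sum λ j → h i j) ≡ false
symmetric-double-sum-even {zero}  h h-sym h-diag = refl
symmetric-double-sum-even {suc n} h h-sym h-diag = begin
  odd (h zero zero + row + sum (λ i → h (suc i) zero + rest i))
    ≡⟨ cong (λ t → odd (t + row + sum (λ i → h (suc i) zero + rest i))) (h-diag zero) ⟩
  odd (row + sum (λ i → h (suc i) zero + rest i))
    ≡⟨ cong (λ t → odd (row + t)) (∑-distrib-+ (λ i → h (suc i) zero) rest) ⟩
  odd (row + (sum (λ i → h (suc i) zero) + sum rest))
    ≡⟨ cong (λ t → odd (row + (t + sum rest))) (sum-cong-≗ λ i → h-sym (suc i) zero) ⟩
  odd (row + (row + sum rest))
    ≡⟨ cong odd (trans (sym (+-assoc row row (sum rest))) (+-comm (row + row) (sum rest))) ⟩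
  odd (sum rest + (row + row))
    ≡⟨ odd-+-double (sum rest) row ⟩
  odd (sum rest)
    ≡⟨ symmetric-double-sum-even (λ i j → h (suc i) (suc j)) (λ i j → h-sym (suc i) (suc j)) (h-diag ∘ suc) ⟩
  false ∎
  where
  open ≡-Reasoning
  row : ℕ
  row = sum λ j → h zero (suc j)
  rest : Fin n → ℕ
  rest i = sum λ j → h (suc i) (suc j)

-- Graphs and perfect matchings

module _ {n} (K : SimpleGraph n) where

  adj-sym : ∀ {x y} → adj K x y ≡ true → adj K y x ≡ true
  adj-sym {x} {y} xy = trans (SimpleGraph.sym K y x) xy

  adj⇒≢ : ∀ {x y} → adj K x y ≡ true → x ≢ y
  adj⇒≢ {x} xy refl with () ← trans (sym xy) (irref K x)

record PerfectMatching {n} (K : SimpleGraph n) : Set where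
  field
    mate            : Fin n → Fin n
    mate-involutive : ∀ x → mate (mate x) ≡ x
    adj-mate        : ∀ x → adj K x (mate x) ≡ true

  mate-≢ : ∀ x → mate x ≢ x
  mate-≢ x = adj⇒≢ K (adj-mate x) ∘ sym

  mate-unique : ∀ {x y} → y ≡ mate x → x ≡ mate y
  mate-unique {x} refl = sym (mate-involutive x)

cubic⇒degree≡3 : ∀ {n} (G : SimpleGraph n) → Cubic G → ∀ v → count (adj G v) ≡ 3
cubic⇒degree≡3 G cubic v = trans (sym (sum-allFin (λ w → ⟦ adj G v w ⟧))) (cubic v)

cubic⇒even-order : ∀ {n} (G : SimpleGraph n) → Cubic G → odd n ≡ false
cubic⇒even-order {n} G cubic = begin
  odd n                                       ≡⟨ odd-*3 n ⟨
  odd (n * 3)                                 ≡⟨ cong odd (trans (sum-cong-≗ (cubic⇒degree≡3 G cubic)) (sum-const n 3)) ⟨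
  odd (sum λ v → sum λ w → ⟦ adj G v w ⟧)     ≡⟨ symmetric-double-sum-even _ symmetric irreflexive ⟩
  false                                       ∎
  where
  open ≡-Reasoning
  symmetric : ∀ v w → ⟦ adj G v w ⟧ ≡ ⟦ adj G w v ⟧
  symmetric v w = cong ⟦_⟧ (SimpleGraph.sym G v w)
  irreflexive : ∀ v → ⟦ adj G v v ⟧ ≡ 0
  irreflexive v = cong ⟦_⟧ (irref G v)

_⊆ᴳ_ : ∀ {n} → SimpleGraph n → SimpleGraph n → Set
K ⊆ᴳ K' = ∀ x y → adj K x y ≡ true → adj K' x y ≡ true

nonEdges : ∀ {n} → SimpleGraph n → ℕ
nonEdges K = sum λ x → sum λ y → ⟦ not (adj K x y) ⟧

nonEdges-< : ∀ {n} {K K' : SimpleGraph n} → K ⊆ᴳ K' →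
             ∀ p q → adj K p q ≡ false → adj K' p q ≡ true → nonEdges K' < nonEdges K
nonEdges-< {K = K} {K'} K⊆K' p q pq∉K pq∈K' =
  sum-mono-< (λ x → sum-mono-≤ (fewer x)) p (sum-mono-< {f = λ y → ⟦ not (adj K' p y) ⟧} (fewer p) q strict)
  where
  ⟦not⟧-antitone : ∀ {a b} → (a ≡ true → b ≡ true) → ⟦ not b ⟧ ≤ ⟦ not a ⟧
  ⟦not⟧-antitone {true}  a⇒b rewrite a⇒b refl = z≤n
  ⟦not⟧-antitone {false} {true}  _ = z≤n
  ⟦not⟧-antitone {false} {false} _ = ≤-refl
  fewer : ∀ x y → ⟦ not (adj K' x y) ⟧ ≤ ⟦ not (adj K x y) ⟧
  fewer x y = ⟦not⟧-antitone (K⊆K' x y)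
  strict : ⟦ not (adj K' p q) ⟧ < ⟦ not (adj K p q) ⟧
  strict rewrite pq∉K | pq∈K' = s≤s z≤n

module _ {n} (K : SimpleGraph n) (p q : Fin n) (p≢q : p ≢ q) where

  isPQ : Fin n → Fin n → Bool
  isPQ x y = (x ≟ᵇ p ∧ y ≟ᵇ q) ∨ (x ≟ᵇ q ∧ y ≟ᵇ p)

  addEdge : SimpleGraph n
  addEdge = record
    { adj   = λ x y → isPQ x y ∨ adj K x y
    ; sym   = λ x y → cong₂ _∨_ (isPQ-sym x y) (SimpleGraph.sym K x y)
    ; irref = λ x → cong₂ _∨_ (isPQ-irrefl x) (irref K x)
    }
    where
    isPQ-sym : ∀ x y → isPQ x y ≡ isPQ y x
    isPQ-sym x y = trans (BP.∨-comm (x ≟ᵇ p ∧ y ≟ᵇ q) _)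
                         (cong₂ _∨_ (BP.∧-comm (x ≟ᵇ q) (y ≟ᵇ p)) (BP.∧-comm (x ≟ᵇ p) (y ≟ᵇ q)))
    isPQ-irrefl : ∀ x → isPQ x x ≡ false
    isPQ-irrefl x with x FP.≟ p | x FP.≟ q
    ... | yes refl | yes refl = ⊥-elim (p≢q refl)
    ... | yes _    | no _     = refl
    ... | no _     | yes _    = refl
    ... | no _     | no _     = refl

  ⊆-addEdge : K ⊆ᴳ addEdge
  ⊆-addEdge x y xy = trans (cong (isPQ x y ∨_) xy) (BP.∨-zeroʳ (isPQ x y))

  adj-addEdge-new : adj addEdge p q ≡ true
  adj-addEdge-new rewrite ≟ᵇ-refl p | ≟ᵇ-refl q = refl

  adj-addEdge⇒ : ∀ {x y} → adj addEdge x y ≡ true →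
                 (x ≡ p × y ≡ q) ⊎ (x ≡ q × y ≡ p) ⊎ adj K x y ≡ true
  adj-addEdge⇒ {x} {y} xy with x FP.≟ p | y FP.≟ q | x FP.≟ q | y FP.≟ p
  ... | yes x≡p | yes y≡q | _       | _       = inj₁ (x≡p , y≡q)
  ... | _       | _       | yes x≡q | yes y≡p = inj₂ (inj₁ (x≡q , y≡p))
  ... | yes _   | no _    | yes _   | no _    = inj₂ (inj₂ xy)
  ... | yes _   | no _    | no _    | _       = inj₂ (inj₂ xy)
  ... | no _    | _       | yes _   | no _    = inj₂ (inj₂ xy)
  ... | no _    | _       | no _    | _       = inj₂ (inj₂ xy)

  addEdge-nonEdges-< : adj K p q ≡ false → nonEdges addEdge < nonEdges K
  addEdge-nonEdges-< pq∉K = nonEdges-< {K = K} {addEdge} ⊆-addEdge p q pq∉K adj-addEdge-new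

-- Alternating walks of two perfect matchings

Least : (ℕ → Set) → Set
Least P = ∃ λ j → P j × (∀ {i} → i < j → ¬ P i)

least : ∀ {P : ℕ → Set} → Decidable P → ∀ {K} → P K → Least P
least {P} P? {K} = <-rec (λ K → P K → Least P) search K
  where
  search : ∀ K → (∀ {i} → i < K → P i → Least P) → P K → Least P
  search K below PK with anyUpTo? P? K
  ... | yes (i , i<K , Pi) = below i<K Pi
  ... | no  ¬below         = K , PK , λ i<K Pi → ¬below (_ , i<K , Pi)

module AlternatingWalk {n} (m₁ m₂ : Fin n → Fin n)
  (m₁-involutive : ∀ x → m₁ (m₁ x) ≡ x) (m₂-involutive : ∀ x → m₂ (m₂ x) ≡ x)
  (m₁-≢ : ∀ x → m₁ x ≢ x) (m₂-≢ : ∀ x → m₂ x ≢ x) (start : Fin n) where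

  mateAt : ℕ → Fin n → Fin n
  mateAt k = if odd k then m₂ else m₁

  mateAt-involutive : ∀ k x → mateAt k (mateAt k x) ≡ x
  mateAt-involutive k x with odd k
  ... | true  = m₂-involutive x
  ... | false = m₁-involutive x

  mateAt-≢ : ∀ k x → mateAt k x ≢ x
  mateAt-≢ k x with odd k
  ... | true  = m₂-≢ x
  ... | false = m₁-≢ x

  mateAt-parity : ∀ k k' → odd k ≡ odd k' → ∀ x → mateAt k x ≡ mateAt k' x
  mateAt-parity _ _ k≡k' x = cong (λ t → (if t then m₂ else m₁) x) k≡k'

  walk : ℕ → Fin n
  walk zero    = start
  walk (suc k) = mateAt k (walk k)

  walk-back : ∀ k → mateAt k (walk (suc k)) ≡ walk k
  walk-back k = mateAt-involutive k (walk k)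

  walk-odd-gap : ∀ δ i → odd δ ≡ true → walk i ≢ walk (i + δ)
  walk-odd-gap (suc zero) i _ eq = mateAt-≢ i (walk i) (trans (cong walk (+-comm 1 i)) (sym eq))
  walk-odd-gap (suc (suc δ)) i odd-δ+2 eq = walk-odd-gap δ (suc i) odd-δ shifted
    where
    odd-δ : odd δ ≡ true
    odd-δ = trans (sym (BP.not-involutive (odd δ))) odd-δ+2
    same-parity : odd i ≡ odd (suc (i + δ))
    same-parity = sym (begin
      odd (suc i + δ)           ≡⟨ odd-+ (suc i) δ ⟩
      not (odd i) xor odd δ     ≡⟨ cong (not (odd i) xor_) odd-δ ⟩
      not (odd i) xor true      ≡⟨ BP.xor-comm (not (odd i)) true ⟩
      not (not (odd i))         ≡⟨ BP.not-involutive (odd i) ⟩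
      odd i                     ∎)
      where open ≡-Reasoning
    shifted : walk (suc i) ≡ walk (suc i + δ)
    shifted = begin
      mateAt i (walk i)                                                ≡⟨ cong (mateAt i) eq ⟩
      mateAt i (walk (i + suc (suc δ)))                                ≡⟨ cong (mateAt i ∘ walk) (trans (+-suc i (suc δ)) (cong suc (+-suc i δ))) ⟩
      mateAt i (mateAt (suc (i + δ)) (walk (suc (i + δ))))             ≡⟨ mateAt-parity i (suc (i + δ)) same-parity _ ⟩
      mateAt (suc (i + δ)) (mateAt (suc (i + δ)) (walk (suc (i + δ)))) ≡⟨ mateAt-involutive (suc (i + δ)) _ ⟩
      walk (suc (i + δ))                                               ∎
      where open ≡-Reasoning

  walk-even-gap : ∀ i δ → odd δ ≡ false → walk i ≡ walk (i + δ) → start ≡ walk δ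
  walk-even-gap zero    δ _      eq = eq
  walk-even-gap (suc i) δ even-δ eq = walk-even-gap i δ even-δ (begin
      walk i                                         ≡⟨ walk-back i ⟨
      mateAt i (walk (suc i))                        ≡⟨ cong (mateAt i) eq ⟩
      mateAt i (mateAt (i + δ) (walk (i + δ)))       ≡⟨ mateAt-parity i (i + δ) same-parity _ ⟩
      mateAt (i + δ) (mateAt (i + δ) (walk (i + δ))) ≡⟨ mateAt-involutive (i + δ) _ ⟩
      walk (i + δ)                                   ∎)
    where
    open ≡-Reasoning
    same-parity : odd i ≡ odd (i + δ)
    same-parity = sym (trans (odd-+ i δ) (trans (cong (odd i xor_) even-δ) (BP.xor-identityʳ (odd i))))

  walk-returns : ∃ λ k → walk k ≡ m₂ start
  walk-returns with FP.pigeonhole (n<1+n n) (λ (k : Fin (suc n)) → walk (toℕ k + toℕ k))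
  ... | i , j , i<j , eq with m≤n⇒∃[o]m+o≡n i<j
  ... | o , 1+i+o≡j = suc (o + o) , (begin
      walk (suc (o + o))                               ≡⟨ walk-back (suc (o + o)) ⟨
      mateAt (suc (o + o)) (walk (suc (suc (o + o))))  ≡⟨ cong (mateAt (suc (o + o))) start≡ ⟨
      mateAt (suc (o + o)) start                       ≡⟨ mateAt-parity (suc (o + o)) 1 (cong not (odd-double o)) start ⟩
      m₂ start                                         ∎)
    where
    open ≡-Reasoning
    I : ℕ
    I = toℕ i
    gap : toℕ j + toℕ j ≡ (I + I) + (suc o + suc o)
    gap = trans (cong (λ t → t + t) (sym (trans (+-suc I o) 1+i+o≡j))) (interchange I (suc o) I (suc o))
    start≡ : start ≡ walk (suc (suc (o + o)))
    start≡ = trans (walk-even-gap (I + I) (suc o + suc o) (odd-double (suc o)) (trans eq (cong walk gap)))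
                   (cong (walk ∘ suc) (+-suc o o))

  m₁-walk : ∀ i → (odd i ≡ false × m₁ (walk i) ≡ walk (suc i)) ⊎ ∃ λ i' → i ≡ suc i' × m₁ (walk i) ≡ walk i'
  m₁-walk zero = inj₁ (refl , refl)
  m₁-walk (suc i) with odd i in odd-i
  ... | true  = inj₁ (refl , refl)
  ... | false = inj₂ (i , refl , m₁-involutive (walk i))

  m₂-walk : ∀ i → (odd i ≡ true × m₂ (walk i) ≡ walk (suc i)) ⊎ i ≡ 0 ⊎
                  ∃ λ i' → i ≡ suc i' × odd i' ≡ true × m₂ (walk i) ≡ walk i'
  m₂-walk zero = inj₂ (inj₁ refl)
  m₂-walk (suc i) with odd i in odd-i
  ... | false = inj₁ (refl , refl)
  ... | true  = inj₂ (inj₂ (i , refl , odd-i , m₂-involutive (walk i)))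

  -- With m₁ a ≡ c and m₂ b ≡ start, the walk returns to b.  Up to its first visit to
  -- {a, b, c} it runs either around an alternating cycle through b that avoids a and c,
  -- or along an alternating path from start to a or to c.
  module FirstContact (a b c : Fin n) (m₁a≡c : m₁ a ≡ c) (m₂b≡start : m₂ b ≡ start)
    (a≢b : a ≢ b) (c≢b : c ≢ b) (a≢c : a ≢ c) where

    record Cycle : Set₁ where
      field
        Z         : Fin n → Set
        Z?        : Decidable Z
        m₁-closed : ∀ {x} → Z x → Z (m₁ x)
        m₂-closed : ∀ {x} → Z x → Z (m₂ x)
        b∈Z       : Z b
        a∉Z       : ¬ Z a
        c∉Z       : ¬ Z c

    record PathTo (a' c' : Fin n) : Set₁ where
      field
        Z         : Fin n → Set
        Z?        : Decidable Z
        m₁-closed : ∀ {x} → Z x → x ≢ a' → Z (m₁ x) × m₁ x ≢ a'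
        m₂-closed : ∀ {x} → Z x → x ≢ start → Z (m₂ x)
        a'∈Z      : Z a'
        start∈Z   : Z start
        b∉Z       : ¬ Z b
        c'∉Z      : ¬ Z c'

    m₂start≡b : m₂ start ≡ b
    m₂start≡b = trans (cong m₂ (sym m₂b≡start)) (m₂-involutive b)

    Hit : ℕ → Set
    Hit k = walk k ≡ a ⊎ walk k ≡ b ⊎ walk k ≡ c

    Hit? : Decidable Hit
    Hit? k = (walk k FP.≟ a) ⊎-dec (walk k FP.≟ b) ⊎-dec (walk k FP.≟ c)

    module UpTo (j : ℕ) (miss : ∀ {i} → i < j → ¬ Hit i) where

      Visited : Fin n → Set
      Visited x = ∃ λ i → i < suc j × walk i ≡ x

      Visited? : Decidable Visited
      Visited? x = anyUpTo? (λ i → walk i FP.≟ x) (suc j)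

      unvisited : ∀ {y} → walk j ≢ y → (∀ {i} → i < j → walk i ≢ y) → ¬ Visited y
      unvisited j≢y i≢y (i , s≤s i≤j , walk-i≡y) with m≤n⇒m<n∨m≡n i≤j
      ... | inj₁ i<j  = i≢y i<j walk-i≡y
      ... | inj₂ refl = j≢y walk-i≡y

      ≢a : ∀ {i} → i < j → walk i ≢ a
      ≢a i<j = miss i<j ∘ inj₁
      ≢b : ∀ {i} → i < j → walk i ≢ b
      ≢b i<j = miss i<j ∘ inj₂ ∘ inj₁
      ≢c : ∀ {i} → i < j → walk i ≢ c
      ≢c i<j = miss i<j ∘ inj₂ ∘ inj₂

      cycle : walk j ≡ b → Cycle
      cycle walk-j≡b = record
        { Z = Visited ; Z? = Visited? ; m₁-closed = m₁-closed ; m₂-closed = m₂-closed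
        ; b∈Z = j , ≤-refl , walk-j≡b
        ; a∉Z = unvisited (λ j≡a → a≢b (trans (sym j≡a) walk-j≡b)) ≢a
        ; c∉Z = unvisited (λ j≡c → c≢b (trans (sym j≡c) walk-j≡b)) ≢c }
        where
        odd-j : odd j ≡ true
        odd-j with m₂-walk j
        ... | inj₁ (odd-j , _) = odd-j
        ... | inj₂ (inj₁ refl) = ⊥-elim (m₂-≢ b (trans m₂b≡start walk-j≡b))
        ... | inj₂ (inj₂ (j' , refl , odd-j' , m₂-j≡j')) =
          ⊥-elim (walk-odd-gap j' 0 odd-j' (sym (trans (sym m₂-j≡j') (trans (cong m₂ walk-j≡b) m₂b≡start))))
        ≢j-if-even : ∀ {i} → odd i ≡ false → i ≢ j
        ≢j-if-even even-i refl with () ← trans (sym even-i) odd-j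
        m₁-closed : ∀ {x} → Visited x → Visited (m₁ x)
        m₁-closed (i , s≤s i≤j , refl) with m₁-walk i
        ... | inj₁ (even-i , m₁≡next) = suc i , s≤s (≤∧≢⇒< i≤j (≢j-if-even even-i)) , sym m₁≡next
        ... | inj₂ (i' , refl , m₁≡prev) = i' , m≤n⇒m≤1+n i≤j , sym m₁≡prev
        m₂-closed : ∀ {x} → Visited x → Visited (m₂ x)
        m₂-closed (i , s≤s i≤j , refl) with m₂-walk i
        ... | inj₂ (inj₁ refl) = j , ≤-refl , trans walk-j≡b (sym m₂start≡b)
        ... | inj₂ (inj₂ (i' , refl , _ , m₂≡prev)) = i' , m≤n⇒m≤1+n i≤j , sym m₂≡prev
        ... | inj₁ (_ , m₂≡next) with m≤n⇒m<n∨m≡n i≤j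
        ...   | inj₁ i<j  = suc i , s≤s i<j , sym m₂≡next
        ...   | inj₂ refl = 0 , s≤s z≤n , sym (trans (cong m₂ walk-j≡b) m₂b≡start)

      path : ∀ a' c' → m₁ a' ≡ c' → walk j ≡ a' → (∀ {i} → i < j → walk i ≢ a' × walk i ≢ c') →
             a' ≢ b → a' ≢ c' → PathTo a' c'
      path a' c' m₁a'≡c' walk-j≡a' miss' a'≢b a'≢c' = record
        { Z = Visited ; Z? = Visited? ; m₁-closed = m₁-closed ; m₂-closed = m₂-closed
        ; a'∈Z = j , ≤-refl , walk-j≡a'
        ; start∈Z = 0 , s≤s z≤n , refl
        ; b∉Z = unvisited (λ j≡b → a'≢b (trans (sym walk-j≡a') j≡b)) ≢b
        ; c'∉Z = unvisited (λ j≡c' → a'≢c' (trans (sym walk-j≡a') j≡c')) (proj₂ ∘ miss') }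
        where
        even-j : odd j ≡ false
        even-j with m₁-walk j
        ... | inj₁ (even-j , _) = even-j
        ... | inj₂ (j' , refl , m₁-j≡j') =
          ⊥-elim (proj₂ (miss' ≤-refl) (trans (sym m₁-j≡j') (trans (cong m₁ walk-j≡a') m₁a'≡c')))
        ≢j-if-odd : ∀ {i} → odd i ≡ true → i ≢ j
        ≢j-if-odd odd-i refl with () ← trans (sym odd-i) even-j
        m₁-closed : ∀ {x} → Visited x → x ≢ a' → Visited (m₁ x) × m₁ x ≢ a'
        m₁-closed (i , s≤s i≤j , refl) x≢a' with m₁-walk i
        ... | inj₁ (even-i , m₁≡next) =
          (suc i , s≤s i<j , sym m₁≡next) , λ next≡a' → proj₁ (miss' 1+i<j) (trans (sym m₁≡next) next≡a')
          where
          i<j : i < j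
          i<j = ≤∧≢⇒< i≤j λ { refl → x≢a' walk-j≡a' }
          1+i<j : suc i < j
          1+i<j = ≤∧≢⇒< i<j (≢j-if-odd (cong not even-i))
        ... | inj₂ (i' , refl , m₁≡prev) =
          (i' , m≤n⇒m≤1+n i≤j , sym m₁≡prev) , λ prev≡a' → proj₁ (miss' i≤j) (trans (sym m₁≡prev) prev≡a')
        m₂-closed : ∀ {x} → Visited x → x ≢ start → Visited (m₂ x)
        m₂-closed (i , s≤s i≤j , refl) x≢start with m₂-walk i
        ... | inj₁ (odd-i , m₂≡next) = suc i , s≤s (≤∧≢⇒< i≤j (≢j-if-odd odd-i)) , sym m₂≡next
        ... | inj₂ (inj₁ refl) = ⊥-elim (x≢start refl)
        ... | inj₂ (inj₂ (i' , refl , _ , m₂≡prev)) = i' , m≤n⇒m≤1+n i≤j , sym m₂≡prev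

    first-contact : Cycle ⊎ PathTo a c ⊎ PathTo c a
    first-contact with walk-returns
    ... | k , walk-k≡m₂start with least Hit? {k} (inj₂ (inj₁ (trans walk-k≡m₂start m₂start≡b)))
    ... | j , hit , miss with hit
    ...   | inj₂ (inj₁ walk-j≡b) = inj₁ (cycle walk-j≡b)
      where open UpTo j miss
    ...   | inj₁ walk-j≡a = inj₂ (inj₁ (path a c m₁a≡c walk-j≡a (λ i<j → ≢a i<j , ≢c i<j) a≢b a≢c))
      where open UpTo j miss
    ...   | inj₂ (inj₂ walk-j≡c) =
      inj₂ (inj₂ (path c a m₁c≡a walk-j≡c (λ i<j → ≢c i<j , ≢a i<j) c≢b (a≢c ∘ sym)))
      where
      open UpTo j miss
      m₁c≡a : m₁ c ≡ a
      m₁c≡a = trans (cong m₁ (sym m₁a≡c)) (m₁-involutive a)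

-- Combining two perfect matchings, and the induction on non-edges

module _ {n} {K : SimpleGraph n} where

  glue-matchings : (Z : Fin n → Set) → Decidable Z → (g h : Fin n → Fin n) →
    (∀ {x} → Z x → Z (g x) × g (g x) ≡ x × adj K x (g x) ≡ true) →
    (∀ {x} → ¬ Z x → ¬ Z (h x) × h (h x) ≡ x × adj K x (h x) ≡ true) → PerfectMatching K
  glue-matchings Z Z? g h g-ok h-ok = record
    { mate = mate ; mate-involutive = involutive ; adj-mate = adj-mate }
    where
    mate : Fin n → Fin n
    mate x with Z? x
    ... | yes _ = g x
    ... | no  _ = h x
    mate-in : ∀ {x} → Z x → mate x ≡ g x
    mate-in {x} x∈Z with Z? x
    ... | yes _   = refl
    ... | no  x∉Z = ⊥-elim (x∉Z x∈Z)
    mate-out : ∀ {x} → ¬ Z x → mate x ≡ h x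
    mate-out {x} x∉Z with Z? x
    ... | yes x∈Z = ⊥-elim (x∉Z x∈Z)
    ... | no  _   = refl
    involutive : ∀ x → mate (mate x) ≡ x
    involutive x with Z? x
    ... | yes x∈Z = let gx∈Z , ggx≡x , _ = g-ok x∈Z in trans (mate-in gx∈Z) ggx≡x
    ... | no  x∉Z = let hx∉Z , hhx≡x , _ = h-ok x∉Z in trans (mate-out hx∉Z) hhx≡x
    adj-mate : ∀ x → adj K x (mate x) ≡ true
    adj-mate x with Z? x
    ... | yes x∈Z = proj₂ (proj₂ (g-ok x∈Z))
    ... | no  x∉Z = proj₂ (proj₂ (h-ok x∉Z))

rematch : ∀ {n} → Fin n → Fin n → (Fin n → Fin n) → Fin n → Fin n
rematch a b h x with x FP.≟ a | x FP.≟ b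
... | yes _ | _     = b
... | no _  | yes _ = a
... | no _  | no _  = h x

module _ {n} (a b : Fin n) (h : Fin n → Fin n) where

  rematch-a : rematch a b h a ≡ b
  rematch-a with a FP.≟ a
  ... | yes _   = refl
  ... | no  a≢a = ⊥-elim (a≢a refl)

  rematch-b : a ≢ b → rematch a b h b ≡ a
  rematch-b a≢b with b FP.≟ a | b FP.≟ b
  ... | yes b≡a | _       = ⊥-elim (a≢b (sym b≡a))
  ... | no _    | yes _   = refl
  ... | no _    | no  b≢b = ⊥-elim (b≢b refl)

  rematch-other : ∀ {x} → x ≢ a → x ≢ b → rematch a b h x ≡ h x
  rematch-other {x} x≢a x≢b with x FP.≟ a | x FP.≟ b
  ... | yes x≡a | _       = ⊥-elim (x≢a x≡a)
  ... | no _    | yes x≡b = ⊥-elim (x≢b x≡b)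
  ... | no _    | no _    = refl

module _ {n} (K : SimpleGraph n) {p q : Fin n} (p≢q : p ≢ q) (M : PerfectMatching (addEdge K p q p≢q)) where
  open PerfectMatching M

  adj-mate-away : ∀ {x} → x ≢ p → x ≢ q → adj K x (mate x) ≡ true
  adj-mate-away {x} x≢p x≢q with adj-addEdge⇒ K p q p≢q (adj-mate x)
  ... | inj₁ (x≡p , _)        = ⊥-elim (x≢p x≡p)
  ... | inj₂ (inj₁ (x≡q , _)) = ⊥-elim (x≢q x≡q)
  ... | inj₂ (inj₂ x-mate∈K)  = x-mate∈K

  avoiding-new-edge : mate p ≢ q → PerfectMatching K
  avoiding-new-edge mate-p≢q = record
    { mate = mate ; mate-involutive = mate-involutive ; adj-mate = adj-mate-K }
    where
    adj-mate-K : ∀ x → adj K x (mate x) ≡ true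
    adj-mate-K x with adj-addEdge⇒ K p q p≢q (adj-mate x)
    ... | inj₁ (refl , mate-p≡q)       = ⊥-elim (mate-p≢q mate-p≡q)
    ... | inj₂ (inj₁ (refl , mate-q≡p)) = ⊥-elim (mate-p≢q (sym (mate-unique (sym mate-q≡p))))
    ... | inj₂ (inj₂ x-mate∈K)         = x-mate∈K

module _ {n} (K : SimpleGraph n) {a b c d : Fin n} (ab∈K : adj K a b ≡ true) (bc∈K : adj K b c ≡ true)
  (a≢c : a ≢ c) (b≢d : b ≢ d)
  (M₁ : PerfectMatching (addEdge K a c a≢c)) (M₂ : PerfectMatching (addEdge K b d b≢d)) where

  open PerfectMatching M₁ using () renaming (mate to m₁; mate-involutive to m₁-involutive; mate-≢ to m₁-≢)
  open PerfectMatching M₂ using ()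
    renaming (mate to m₂; mate-involutive to m₂-involutive; mate-≢ to m₂-≢; mate-unique to m₂-unique)

  private
    m₁-away : ∀ {x} → x ≢ a → x ≢ c → adj K x (m₁ x) ≡ true
    m₁-away = adj-mate-away K a≢c M₁
    m₂-away : ∀ {x} → x ≢ b → x ≢ d → adj K x (m₂ x) ≡ true
    m₂-away = adj-mate-away K b≢d M₂

  module BothNewEdgesUsed (m₁a≡c : m₁ a ≡ c) (m₂b≡d : m₂ b ≡ d) where
    open AlternatingWalk m₁ m₂ m₁-involutive m₂-involutive m₁-≢ m₂-≢ d
    open FirstContact a b c m₁a≡c m₂b≡d (adj⇒≢ K ab∈K) (adj⇒≢ K (adj-sym K bc∈K)) a≢c

    m₂d≡b : m₂ d ≡ b
    m₂d≡b = sym (m₂-unique (sym m₂b≡d))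

    from-cycle : Cycle → PerfectMatching K
    from-cycle C = glue-matchings Z Z? m₁ m₂
      (λ x∈Z → m₁-closed x∈Z , m₁-involutive _ , m₁-away (λ { refl → a∉Z x∈Z }) (λ { refl → c∉Z x∈Z }))
      (λ x∉Z → (λ m₂x∈Z → x∉Z (subst Z (m₂-involutive _) (m₂-closed m₂x∈Z))) , m₂-involutive _ ,
               m₂-away (λ { refl → x∉Z b∈Z }) (λ { refl → x∉Z (subst Z m₂b≡d (m₂-closed b∈Z)) }))
      where open Cycle C

    -- On the path the m₁-edge a'c' is traded for the K-edge a'b.
    from-path : ∀ {a' c'} → PathTo a' c' → adj K a' b ≡ true →
                (∀ {x} → x ≢ a' → x ≢ c' → adj K x (m₁ x) ≡ true) → PerfectMatching K
    from-path {a'} {c'} P a'b∈K m₁-edge = glue-matchings Z' Z'? g m₂ g-ok m₂-ok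
      where
      open PathTo P
      Z' : Fin n → Set
      Z' x = Z x ⊎ x ≡ b
      Z'? : Decidable Z'
      Z'? x = Z? x ⊎-dec (x FP.≟ b)
      a'≢b : a' ≢ b
      a'≢b a'≡b = b∉Z (subst Z a'≡b a'∈Z)
      g : Fin n → Fin n
      g = rematch a' b m₁
      g-ok : ∀ {x} → Z' x → Z' (g x) × g (g x) ≡ x × adj K x (g x) ≡ true
      g-ok (inj₂ refl) rewrite rematch-b a' b m₁ a'≢b =
        inj₁ a'∈Z , rematch-a a' b m₁ , adj-sym K a'b∈K
      g-ok (inj₁ x∈Z) = g-ok-path x∈Z (_ FP.≟ a')
        where
        g-ok-path : ∀ {x} → Z x → Dec (x ≡ a') → Z' (g x) × g (g x) ≡ x × adj K x (g x) ≡ true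
        g-ok-path _ (yes refl) rewrite rematch-a a' b m₁ = inj₂ refl , rematch-b a' b m₁ a'≢b , a'b∈K
        g-ok-path {x} x∈Z (no x≢a') =
          subst Z' (sym g-x) (inj₁ m₁x∈Z) , trans (cong g g-x) g-m₁x ,
          subst (λ y → adj K x y ≡ true) (sym g-x) (m₁-edge x≢a' λ { refl → c'∉Z x∈Z })
          where
          m₁x∈Z : Z (m₁ x)
          m₁x∈Z = proj₁ (m₁-closed x∈Z x≢a')
          g-x : g x ≡ m₁ x
          g-x = rematch-other a' b m₁ x≢a' λ { refl → b∉Z x∈Z }
          g-m₁x : g (m₁ x) ≡ x
          g-m₁x = trans (rematch-other a' b m₁ (proj₂ (m₁-closed x∈Z x≢a')) λ { refl → b∉Z m₁x∈Z })
                        (m₁-involutive x)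
      m₂-ok : ∀ {x} → ¬ Z' x → ¬ Z' (m₂ x) × m₂ (m₂ x) ≡ x × adj K x (m₂ x) ≡ true
      m₂-ok {x} x∉Z' = m₂x∉Z' , m₂-involutive x ,
                        m₂-away (λ x≡b → x∉Z' (inj₂ x≡b)) (λ { refl → x∉Z' (inj₁ start∈Z) })
        where
        m₂x∉Z' : ¬ Z' (m₂ x)
        m₂x∉Z' (inj₂ m₂x≡b) = x∉Z' (inj₁ (subst Z (sym (trans (m₂-unique (sym m₂x≡b)) m₂b≡d)) start∈Z))
        m₂x∉Z' (inj₁ m₂x∈Z) with m₂ x FP.≟ d
        ... | yes m₂x≡d = x∉Z' (inj₂ (trans (m₂-unique (sym m₂x≡d)) m₂d≡b))
        ... | no  m₂x≢d = x∉Z' (inj₁ (subst Z (m₂-involutive x) (m₂-closed m₂x∈Z m₂x≢d)))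

    perfectMatching : PerfectMatching K
    perfectMatching with first-contact
    ... | inj₁ C        = from-cycle C
    ... | inj₂ (inj₁ P) = from-path P ab∈K m₁-away
    ... | inj₂ (inj₂ P) = from-path P (adj-sym K bc∈K) (λ x≢c x≢a → m₁-away x≢a x≢c)

  perfectMatching-from-two : PerfectMatching K
  perfectMatching-from-two with m₁ a FP.≟ c | m₂ b FP.≟ d
  ... | no m₁a≢c  | _         = avoiding-new-edge K a≢c M₁ m₁a≢c
  ... | yes _     | no m₂b≢d  = avoiding-new-edge K b≢d M₂ m₂b≢d
  ... | yes m₁a≡c | yes m₂b≡d = BothNewEdgesUsed.perfectMatching m₁a≡c m₂b≡d

module _ {n} (K : SimpleGraph n) where

  Universal : Fin n → Set
  Universal x = ∀ y → y ≢ x → adj K x y ≡ true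

  Universal? : Decidable Universal
  Universal? x = FP.all? λ y → ¬? (y FP.≟ x) →-dec (adj K x y BP.≟ true)

  non-neighbour : ∀ {x} → ¬ Universal x → ∃ λ y → y ≢ x × adj K x y ≡ false
  non-neighbour {x} ¬univ with FP.¬∀⟶∃¬ n _ (λ y → ¬? (y FP.≟ x) →-dec (adj K x y BP.≟ true)) ¬univ
  ... | y , ¬[y≢x→xy] with y FP.≟ x | adj K x y in xy
  ... | yes refl | _     = ⊥-elim (¬[y≢x→xy] λ x≢x → ⊥-elim (x≢x refl))
  ... | no  y≢x  | false = y , y≢x , xy
  ... | no  _    | true  = ⊥-elim (¬[y≢x→xy] λ _ → refl)

  InducedP₃ : Fin n → Fin n → Fin n → Set
  InducedP₃ a b c = adj K a b ≡ true × adj K b c ≡ true × adj K a c ≡ false × a ≢ c × ¬ Universal b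

  InducedP₃? : ∀ a b c → Dec (InducedP₃ a b c)
  InducedP₃? a b c = (adj K a b BP.≟ true) ×-dec (adj K b c BP.≟ true) ×-dec (adj K a c BP.≟ false) ×-dec
                     ¬? (a FP.≟ c) ×-dec ¬? (Universal? b)

module Saturation {n} (G : SimpleGraph n)
  (P₃-free-case : ∀ K → G ⊆ᴳ K → (∀ a b c → ¬ InducedP₃ K a b c) → PerfectMatching K) where

  perfectMatching-⊇ : ∀ K → G ⊆ᴳ K → PerfectMatching K
  perfectMatching-⊇ = All.wfRec (On.wellFounded nonEdges <-wellFounded) 0ℓ
                                (λ K → G ⊆ᴳ K → PerfectMatching K) step
    where
    step : ∀ K → (∀ {K'} → nonEdges K' < nonEdges K → G ⊆ᴳ K' → PerfectMatching K') →
           G ⊆ᴳ K → PerfectMatching K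
    step K smaller G⊆K with FP.any? (λ a → FP.any? (λ b → FP.any? (λ c → InducedP₃? K a b c)))
    ... | no ¬P₃ = P₃-free-case K G⊆K λ a b c P₃ → ¬P₃ (a , b , c , P₃)
    ... | yes (a , b , c , ab∈K , bc∈K , ac∉K , a≢c , ¬univ) with non-neighbour K ¬univ
    ... | d , d≢b , bd∉K =
      perfectMatching-from-two K ab∈K bc∈K a≢c (d≢b ∘ sym) (recurse a≢c ac∉K) (recurse (d≢b ∘ sym) bd∉K)
      where
      recurse : ∀ {p q} (p≢q : p ≢ q) → adj K p q ≡ false → PerfectMatching (addEdge K p q p≢q)
      recurse {p} {q} p≢q pq∉K =
        smaller (addEdge-nonEdges-< K p q p≢q pq∉K) λ x y xy∈G → ⊆-addEdge K p q p≢q x y (G⊆K x y xy∈G)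

-- Supergraphs without an induced path through a non-universal vertex

module Cliques {n} (K : SimpleGraph n) (P₃-free : ∀ a b c → ¬ InducedP₃ K a b c) where

  Near : Fin n → Fin n → Set
  Near x y = y ≡ x ⊎ adj K x y ≡ true

  near-sym : ∀ {x y} → Near x y → Near y x
  near-sym (inj₁ refl) = inj₁ refl
  near-sym (inj₂ xy)   = inj₂ (adj-sym K xy)

  near-trans : ∀ {x y z} → ¬ Universal K y → Near x y → Near y z → Near x z
  near-trans _ (inj₁ refl) yz          = yz
  near-trans _ xy          (inj₁ refl) = xy
  near-trans {x} {y} {z} ¬univ (inj₂ xy) (inj₂ yz) with z FP.≟ x | adj K x z in xz
  ... | yes z≡x | _     = inj₁ z≡x
  ... | no  _   | true  = inj₂ refl
  ... | no  z≢x | false = ⊥-elim (P₃-free x y z (xy , yz , xz , z≢x ∘ sym , ¬univ))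

  InClique : Fin n → Fin n → Set
  InClique x y = ¬ Universal K y × Near x y

  InClique? : ∀ x y → Dec (InClique x y)
  InClique? x y = ¬? (Universal? K y) ×-dec ((y FP.≟ x) ⊎-dec (adj K x y BP.≟ true))

  inClique : Fin n → Fin n → Bool
  inClique x y = does (InClique? x y)

  inU : Fin n → Bool
  inU x = does (Universal? K x)

  clique-self : ∀ {x} → ¬ Universal K x → InClique x x
  clique-self ¬univ = ¬univ , inj₁ refl

  clique-sym : ∀ {x y} → ¬ Universal K x → InClique x y → InClique y x
  clique-sym ¬univ-x (_ , xy) = ¬univ-x , near-sym xy

  clique-trans : ∀ {x y z} → InClique x y → InClique y z → InClique x z
  clique-trans (¬univ-y , xy) (¬univ-z , yz) = ¬univ-z , near-trans ¬univ-y xy yz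

  clique-adj : ∀ {x y z} → InClique x y → ¬ Universal K z → adj K y z ≡ true → InClique x z
  clique-adj x~y ¬univ-z yz = clique-trans x~y (¬univ-z , inj₂ yz)

  inClique-same : ∀ {x y} → ¬ Universal K x → InClique x y → ∀ z → inClique x z ≡ inClique y z
  inClique-same ¬univ-x x~y z = does-⇔ (mk⇔ (clique-trans (clique-sym ¬univ-x x~y)) (clique-trans x~y))
                                        (InClique? _ z) (InClique? _ z)

  inClique-sameʳ : ∀ {x y} → ¬ Universal K x → InClique x y → ∀ z → inClique z x ≡ inClique z y
  inClique-sameʳ ¬univ-x x~y z =
    does-⇔ (mk⇔ (λ z~x → clique-trans z~x x~y) (λ z~y → clique-trans z~y (clique-sym ¬univ-x x~y)))
           (InClique? z _) (InClique? z _)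

  universal-outside : ∀ {x y} → Universal K y → inClique x y ≡ false
  universal-outside {x} {y} univ = dec-false (InClique? x y) λ (¬univ , _) → ¬univ univ

  inW : Fin n → Bool
  inW x = not (inU x)

  inW-true : ∀ {x} → ¬ Universal K x → inW x ≡ true
  inW-true {x} ¬univ = cong not (dec-false (Universal? K x) ¬univ)

  inW-false : ∀ {x} → Universal K x → inW x ≡ false
  inW-false {x} univ = cong not (dec-true (Universal? K x) univ)

  not-in-U : ∀ {x} → ¬ Universal K x → ⟦ inU x ⟧ ≡ 0
  not-in-U {x} ¬univ = cong ⟦_⟧ (dec-false (Universal? K x) ¬univ)

  in-U : ∀ {x} → Universal K x → ⟦ inU x ⟧ ≡ 1
  in-U {x} univ = cong ⟦_⟧ (dec-true (Universal? K x) univ)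

module CubicSupergraph {n} (G : SimpleGraph n) (cubic : Cubic G) (bridgeless : Bridgeless G)
  (K : SimpleGraph n) (G⊆K : G ⊆ᴳ K) (P₃-free : ∀ a b c → ¬ InducedP₃ K a b c) where

  open Cliques K P₃-free public

  degree≡3 : ∀ v → count (adj G v) ≡ 3
  degree≡3 = cubic⇒degree≡3 G cubic

  cliqueSize : Fin n → ℕ
  cliqueSize x = sum λ y → ⟦ inClique x y ⟧

  edgesToU : Fin n → ℕ
  edgesToU y = sum λ u → ⟦ inU u ∧ adj G y u ⟧

  cliqueEdgesToU : Fin n → ℕ
  cliqueEdgesToU x = sum λ y → ⟦ inClique x y ⟧ * edgesToU y

  neighbour-split : ∀ {x y} → InClique x y → ∀ w →
                    ⟦ adj G y w ⟧ ≡ ⟦ inClique x w ∧ adj G y w ⟧ + ⟦ inU w ∧ adj G y w ⟧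
  neighbour-split {x} {y} x~y w with adj G y w in yw
  ... | false rewrite BP.∧-zeroʳ (inClique x w) | BP.∧-zeroʳ (inU w) = refl
  ... | true with Universal? K w
  ...   | yes univ  rewrite dec-false (InClique? x w) (λ (¬univ , _) → ¬univ univ)
                          | dec-true (Universal? K w) univ = refl
  ...   | no  ¬univ rewrite dec-true (InClique? x w) (clique-adj x~y ¬univ (G⊆K y w yw))
                          | dec-false (Universal? K w) ¬univ = refl

  degree-split : ∀ x y → ⟦ inClique x y ⟧ * 3 ≡
                 sum (λ w → ⟦ inClique x y ∧ (inClique x w ∧ adj G y w) ⟧) + ⟦ inClique x y ⟧ * edgesToU y
  degree-split x y with inClique x y in x~y?
  ... | false = sym (trans (+-identityʳ _) (sum-zero {n} {λ _ → 0} λ _ → refl))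
  ... | true  = begin
    3
      ≡⟨ degree≡3 y ⟨
    sum (λ w → ⟦ adj G y w ⟧)
      ≡⟨ sum-cong-≗ (neighbour-split x~y) ⟩
    sum (λ w → ⟦ inClique x w ∧ adj G y w ⟧ + ⟦ inU w ∧ adj G y w ⟧)
      ≡⟨ ∑-distrib-+ (λ w → ⟦ inClique x w ∧ adj G y w ⟧) _ ⟩
    sum (λ w → ⟦ inClique x w ∧ adj G y w ⟧) + edgesToU y
      ≡⟨ cong (sum (λ w → ⟦ inClique x w ∧ adj G y w ⟧) +_) (+-identityʳ (edgesToU y)) ⟨
    sum (λ w → ⟦ inClique x w ∧ adj G y w ⟧) + (edgesToU y + 0)
      ∎
    where
    open ≡-Reasoning
    x~y : InClique x y
    x~y = does-true⇒ (InClique? x y) x~y?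

  edgeToU : Fin n → Fin n → Fin n → ℕ
  edgeToU x y u = ⟦ inClique x y ⟧ * ⟦ inU u ∧ adj G y u ⟧

  edgeToU-pos : ∀ {x y u} → InClique x y → Universal K u → adj G y u ≡ true → 0 < edgeToU x y u
  edgeToU-pos {x} {y} {u} x~y univ yu
    rewrite dec-true (InClique? x y) x~y | dec-true (Universal? K u) univ | yu = s≤s z≤n

  edgeToU-pos⇒ : ∀ {x y u} → 0 < edgeToU x y u → InClique x y × Universal K u × adj G y u ≡ true
  edgeToU-pos⇒ {x} {y} {u} pos with ⟦⟧*⟦⟧-pos {inClique x y} pos
  ... | x~y , uy with ∧≡true uy
  ...   | univ , yu = does-true⇒ (InClique? x y) x~y , does-true⇒ (Universal? K u) univ , yu

  cliqueEdgesToU-as-double-sum : ∀ x → cliqueEdgesToU x ≡ sum (λ y → sum (edgeToU x y))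
  cliqueEdgesToU-as-double-sum x = sum-cong-≗ λ y → *-distribˡ-sum ⟦ inClique x y ⟧ (λ u → ⟦ inU u ∧ adj G y u ⟧)

  unique-edgeToU⇒bridge : ∀ {x y₀ u₀} → 0 < edgeToU x y₀ u₀ →
                          (∀ {y u} → 0 < edgeToU x y u → y₀ ≡ y × u₀ ≡ u) → IsBridge G y₀ u₀
  unique-edgeToU⇒bridge {x} {y₀} {u₀} 0<edge unique = y₀u₀∈G , λ detour → proj₁ (stays x~y₀ detour) univ-u₀
    where
    x~y₀ : InClique x y₀
    x~y₀ = proj₁ (edgeToU-pos⇒ 0<edge)
    univ-u₀ : Universal K u₀
    univ-u₀ = proj₁ (proj₂ (edgeToU-pos⇒ 0<edge))
    y₀u₀∈G : adj G y₀ u₀ ≡ true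
    y₀u₀∈G = proj₂ (proj₂ (edgeToU-pos⇒ 0<edge))
    stays : ∀ {z w} → InClique x z → Star (AdjMinus G y₀ u₀) z w → InClique x w
    stays x~z ε = x~z
    stays {z} x~z (_◅_ {j = z'} (zz'∈G , not-y₀u₀ , _) detour) with Universal? K z'
    ... | no  ¬univ = stays (clique-adj x~z ¬univ (G⊆K z z' zz'∈G)) detour
    ... | yes univ  =
      ⊥-elim (not-y₀u₀ (let y₀≡z , u₀≡z' = unique (edgeToU-pos x~z univ zz'∈G) in sym y₀≡z , sym u₀≡z'))

  cliqueEdgesToU≢1 : ∀ {x} → cliqueEdgesToU x ≢ 1
  cliqueEdgesToU≢1 {x} S≡1 =
    bridgeless y₀ u₀ (unique-edgeToU⇒bridge 0<edge (double-sum≡1-unique (edgeToU x) total≡1 0<edge))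
    where
    total≡1 : sum (λ y → sum (edgeToU x y)) ≡ 1
    total≡1 = trans (sym (cliqueEdgesToU-as-double-sum x)) S≡1
    y₀u₀ : ∃ λ y₀ → ∃ λ u₀ → 0 < edgeToU x y₀ u₀
    y₀u₀ with sum-pos (λ y → sum (edgeToU x y)) (subst (0 <_) (sym total≡1) (s≤s z≤n))
    ... | y₀ , 0<row = y₀ , sum-pos (edgeToU x y₀) 0<row
    y₀ u₀ : Fin n
    y₀ = proj₁ y₀u₀
    u₀ = proj₁ (proj₂ y₀u₀)
    0<edge : 0 < edgeToU x y₀ u₀
    0<edge = proj₂ (proj₂ y₀u₀)

  odd-clique⇒edgesToU≥3 : ∀ {x} → ¬ Universal K x → odd (cliqueSize x) ≡ true → 3 ≤ cliqueEdgesToU x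
  odd-clique⇒edgesToU≥3 {x} ¬univ odd-size = odd∧≢1⇒≥3 _ odd-S cliqueEdgesToU≢1
    where
    open ≡-Reasoning
    internal : Fin n → Fin n → ℕ
    internal y w = ⟦ inClique x y ∧ (inClique x w ∧ adj G y w) ⟧
    internal-sym : ∀ y w → internal y w ≡ internal w y
    internal-sym y w = cong ⟦_⟧ (trans (cong (λ e → inClique x y ∧ (inClique x w ∧ e)) (SimpleGraph.sym G y w))
                                       (∧-swap (inClique x y) (inClique x w) (adj G w y)))
    internal-diag : ∀ y → internal y y ≡ 0
    internal-diag y rewrite irref G y | BP.∧-zeroʳ (inClique x y) = cong ⟦_⟧ (BP.∧-zeroʳ (inClique x y))
    double-count : cliqueSize x * 3 ≡ sum (λ y → sum (internal y)) + cliqueEdgesToU x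
    double-count = begin
      cliqueSize x * 3                                                     ≡⟨ *-distribʳ-sum 3 (λ y → ⟦ inClique x y ⟧) ⟩
      sum (λ y → ⟦ inClique x y ⟧ * 3)                                     ≡⟨ sum-cong-≗ (degree-split x) ⟩
      sum (λ y → sum (internal y) + ⟦ inClique x y ⟧ * edgesToU y)         ≡⟨ ∑-distrib-+ (λ y → sum (internal y)) _ ⟩
      sum (λ y → sum (internal y)) + cliqueEdgesToU x                      ∎
    odd-S : odd (cliqueEdgesToU x) ≡ true
    odd-S = begin
      odd (cliqueEdgesToU x)
        ≡⟨ cong (_xor odd (cliqueEdgesToU x)) (symmetric-double-sum-even internal internal-sym internal-diag) ⟨
      odd (sum (λ y → sum (internal y))) xor odd (cliqueEdgesToU x)
        ≡⟨ odd-+ (sum (λ y → sum (internal y))) (cliqueEdgesToU x) ⟨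
      odd (sum (λ y → sum (internal y)) + cliqueEdgesToU x)
        ≡⟨ cong odd double-count ⟨
      odd (cliqueSize x * 3)
        ≡⟨ odd-*3 (cliqueSize x) ⟩
      odd (cliqueSize x)
        ≡⟨ odd-size ⟩
      true
        ∎

-- Greedy matching

record PartialMatching {n} (K : SimpleGraph n) : Set where
  field
    mate            : Fin n → Fin n
    mate-involutive : ∀ x → mate (mate x) ≡ x
    adj-mate        : ∀ x → mate x ≢ x → adj K x (mate x) ≡ true

  free : Fin n → Bool
  free x = mate x ≟ᵇ x

  countFree : (Fin n → Bool) → ℕ
  countFree c = sum λ z → ⟦ c z ∧ free z ⟧

  freeCount : ℕ
  freeCount = countFree λ _ → true

open PartialMatching using (free; countFree; freeCount)

emptyMatching : ∀ {n} (K : SimpleGraph n) → PartialMatching K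
emptyMatching K = record { mate = λ x → x ; mate-involutive = λ _ → refl ; adj-mate = λ x x≢x → ⊥-elim (x≢x refl) }

module _ {n} {K : SimpleGraph n} (M : PartialMatching K) where
  open PartialMatching M using (mate; mate-involutive; adj-mate)

  free⇒fixed : ∀ {x} → free M x ≡ true → mate x ≡ x
  free⇒fixed = ≟ᵇ⇒≡

  unfree⇒moved : ∀ {x} → free M x ≡ false → mate x ≢ x
  unfree⇒moved {x} = does-false⇒ (mate x FP.≟ x)

  perfect : (∀ x → free M x ≡ false) → PerfectMatching K
  perfect none-free = record
    { mate = mate ; mate-involutive = mate-involutive
    ; adj-mate = λ x → adj-mate x (unfree⇒moved (none-free x)) }

  module _ {x y : Fin n} (x≢y : x ≢ y) (x-free : free M x ≡ true) (y-free : free M y ≡ true)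
           (xy∈K : adj K x y ≡ true) where

    private
      m : Fin n → Fin n
      m = rematch x y mate
      m-other : ∀ {z} → z ≢ x → z ≢ y → m z ≡ mate z
      m-other = rematch-other x y mate
      mate-≢ : ∀ {z w} → z ≢ w → mate w ≡ w → mate z ≢ w
      mate-≢ {z} z≢w fixed mz≡w = z≢w (trans (sym (mate-involutive z)) (trans (cong mate mz≡w) fixed))

    matchPair : PartialMatching K
    matchPair = record { mate = m ; mate-involutive = involutive ; adj-mate = adjacent }
      where
      involutive : ∀ z → m (m z) ≡ z
      involutive z = cases (z FP.≟ x) (z FP.≟ y)
        where
        cases : Dec (z ≡ x) → Dec (z ≡ y) → m (m z) ≡ z
        cases (yes refl) _ = trans (cong m (rematch-a x y mate)) (rematch-b x y mate x≢y)
        cases (no _) (yes refl) = trans (cong m (rematch-b x y mate x≢y)) (rematch-a x y mate)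
        cases (no z≢x) (no z≢y) =
          trans (cong m (m-other z≢x z≢y))
                (trans (m-other (mate-≢ z≢x (free⇒fixed x-free)) (mate-≢ z≢y (free⇒fixed y-free))) (mate-involutive z))
      adjacent : ∀ z → m z ≢ z → adj K z (m z) ≡ true
      adjacent z mz≢z = cases (z FP.≟ x) (z FP.≟ y)
        where
        cases : Dec (z ≡ x) → Dec (z ≡ y) → adj K z (m z) ≡ true
        cases (yes refl) _ rewrite rematch-a x y mate = xy∈K
        cases (no _) (yes refl) rewrite rematch-b x y mate x≢y = adj-sym K xy∈K
        cases (no z≢x) (no z≢y) =
          subst (λ w → adj K z w ≡ true) (sym (m-other z≢x z≢y))
                (adj-mate z (λ fixed → mz≢z (trans (m-other z≢x z≢y) fixed)))

    free-matchPair-x : free matchPair x ≡ false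
    free-matchPair-x = trans (cong (_≟ᵇ x) (rematch-a x y mate)) (≟ᵇ-≢ (x≢y ∘ sym))

    free-matchPair-y : free matchPair y ≡ false
    free-matchPair-y = trans (cong (_≟ᵇ y) (rematch-b x y mate x≢y)) (≟ᵇ-≢ x≢y)

    free-matchPair-other : ∀ {z} → z ≢ x → z ≢ y → free matchPair z ≡ free M z
    free-matchPair-other {z} z≢x z≢y = cong (_≟ᵇ z) (m-other z≢x z≢y)

    free-matchPair⇒free : ∀ {z} → free matchPair z ≡ true → free M z ≡ true
    free-matchPair⇒free {z} free' = cases (z FP.≟ x) (z FP.≟ y)
      where
      cases : Dec (z ≡ x) → Dec (z ≡ y) → free M z ≡ true
      cases (yes refl) _          = x-free
      cases (no _)     (yes refl) = y-free
      cases (no z≢x)   (no z≢y)   = trans (sym (free-matchPair-other z≢x z≢y)) free'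

    countFree-matchPair : ∀ c → countFree M c ≡ countFree matchPair c + (⟦ c x ⟧ + ⟦ c y ⟧)
    countFree-matchPair c = begin
      sum F                  ≡⟨ +-identityʳ (sum F) ⟨
      sum F + 0              ≡⟨ cong (sum F +_) (cong₂ _+_ (removed x free-matchPair-x) (removed y free-matchPair-y)) ⟨
      sum F + (F' x + F' y)  ≡⟨ sum-update₂ F F' x≢y unchanged ⟩
      sum F' + (F x + F y)   ≡⟨ cong (sum F' +_) (cong₂ _+_ (kept x x-free) (kept y y-free)) ⟩
      sum F' + (⟦ c x ⟧ + ⟦ c y ⟧) ∎
      where
      open ≡-Reasoning
      F F' : Fin n → ℕ
      F z = ⟦ c z ∧ free M z ⟧
      F' z = ⟦ c z ∧ free matchPair z ⟧
      unchanged : ∀ z → z ≢ x → z ≢ y → F z ≡ F' z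
      unchanged z z≢x z≢y = cong (λ f → ⟦ c z ∧ f ⟧) (sym (free-matchPair-other z≢x z≢y))
      removed : ∀ z → free matchPair z ≡ false → F' z ≡ 0
      removed z unfree rewrite unfree = cong ⟦_⟧ (BP.∧-zeroʳ (c z))
      kept : ∀ z → free M z ≡ true → F z ≡ ⟦ c z ⟧
      kept z is-free rewrite is-free = cong ⟦_⟧ (BP.∧-identityʳ (c z))

    freeCount-matchPair : freeCount M ≡ freeCount matchPair + 2
    freeCount-matchPair = countFree-matchPair λ _ → true

module Greedy {n} (G : SimpleGraph n) (cubic : Cubic G) (bridgeless : Bridgeless G)
  (K : SimpleGraph n) (G⊆K : G ⊆ᴳ K) (P₃-free : ∀ a b c → ¬ InducedP₃ K a b c) where

  open CubicSupergraph G cubic bridgeless K G⊆K P₃-free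
  open PartialMatching

  freeInClique : PartialMatching K → Fin n → ℕ
  freeInClique M x = countFree M (inClique x)

  freeU : PartialMatching K → ℕ
  freeU M = countFree M inU

  demand : PartialMatching K → ℕ
  demand M = sum λ x → ⟦ inW x ∧ odd (freeInClique M x) ⟧ * edgesToU x

  -- demand M counts the G-edges from cliques with an odd number of free vertices into U,
  -- at least 3 per such clique; so demand≤supply leaves a free vertex of U for the last
  -- free vertex of any clique.
  record Invariant (M : PartialMatching K) : Set where
    field
      even-free           : odd (freeCount M) ≡ false
      odd-free⇒odd-clique : ∀ {x} → ¬ Universal K x → odd (freeInClique M x) ≡ true → odd (cliqueSize x) ≡ true
      demand≤supply       : demand M ≤ 3 * freeU M
  open Invariant

  Improvement : PartialMatching K → Set
  Improvement M = Σ (PartialMatching K) λ M' → Invariant M' × freeCount M' < freeCount M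

  demand-cong : ∀ M M' → (∀ {z} → ¬ Universal K z → odd (freeInClique M' z) ≡ odd (freeInClique M z)) →
                demand M' ≡ demand M
  demand-cong M M' same = sum-cong-≗ term
    where
    term : ∀ z → ⟦ inW z ∧ odd (freeInClique M' z) ⟧ * edgesToU z ≡ ⟦ inW z ∧ odd (freeInClique M z) ⟧ * edgesToU z
    term z with Universal? K z
    ... | yes univ  rewrite inW-false univ = refl
    ... | no  ¬univ rewrite inW-true ¬univ | same ¬univ = refl

  module Matched (M : PartialMatching K) (inv : Invariant M) {x y : Fin n} (x≢y : x ≢ y)
           (x-free : free M x ≡ true) (y-free : free M y ≡ true) (xy∈K : adj K x y ≡ true) where

    M' : PartialMatching K
    M' = matchPair M x≢y x-free y-free xy∈K

    fewer-free : freeCount M' < freeCount M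
    fewer-free = subst (freeCount M' <_) (sym (freeCount-matchPair M x≢y x-free y-free xy∈K))
                       (m<m+n (freeCount M') (s≤s z≤n))

    even-free' : odd (freeCount M') ≡ false
    even-free' = trans (sym (odd-+-double (freeCount M') 1))
                       (trans (cong odd (sym (freeCount-matchPair M x≢y x-free y-free xy∈K))) (even-free inv))

    freeInClique-matchPair : ∀ z → freeInClique M z ≡ freeInClique M' z + (⟦ inClique z x ⟧ + ⟦ inClique z y ⟧)
    freeInClique-matchPair z = countFree-matchPair M x≢y x-free y-free xy∈K (inClique z)

    freeU-matchPair : freeU M ≡ freeU M' + (⟦ inU x ⟧ + ⟦ inU y ⟧)
    freeU-matchPair = countFree-matchPair M x≢y x-free y-free xy∈K inU

  match-in-clique : ∀ M → Invariant M → ∀ {x y} → ¬ Universal K x → x ≢ y →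
                    free M x ≡ true → free M y ≡ true → InClique x y → Improvement M
  match-in-clique M inv {x} {y} ¬univ-x x≢y x-free y-free x~y = M' , invariant , fewer-free
    where
    xy∈K : adj K x y ≡ true
    xy∈K with proj₂ x~y
    ... | inj₁ y≡x = ⊥-elim (x≢y (sym y≡x))
    ... | inj₂ xy  = xy
    open Matched M inv x≢y x-free y-free xy∈K
    same-parity : ∀ {z} → ¬ Universal K z → odd (freeInClique M' z) ≡ odd (freeInClique M z)
    same-parity {z} _ = sym (begin
      odd (freeInClique M z)
        ≡⟨ cong odd (freeInClique-matchPair z) ⟩
      odd (freeInClique M' z + (⟦ inClique z x ⟧ + ⟦ inClique z y ⟧))
        ≡⟨ cong (λ t → odd (freeInClique M' z + (⟦ t ⟧ + ⟦ inClique z y ⟧))) (inClique-sameʳ ¬univ-x x~y z) ⟩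
      odd (freeInClique M' z + (⟦ inClique z y ⟧ + ⟦ inClique z y ⟧))
        ≡⟨ odd-+-double (freeInClique M' z) ⟦ inClique z y ⟧ ⟩
      odd (freeInClique M' z)
        ∎)
      where open ≡-Reasoning
    same-freeU : freeU M ≡ freeU M'
    same-freeU = trans freeU-matchPair (trans (cong₂ (λ a b → freeU M' + (a + b)) (not-in-U ¬univ-x) (not-in-U (proj₁ x~y)))
                                              (+-identityʳ (freeU M')))
    invariant : Invariant M'
    invariant = record
      { even-free = even-free'
      ; odd-free⇒odd-clique = λ ¬univ odd-free →
          odd-free⇒odd-clique inv ¬univ (trans (sym (same-parity ¬univ)) odd-free)
      ; demand≤supply =
          subst₂ (λ d f → d ≤ 3 * f) (sym (demand-cong M M' same-parity)) same-freeU (demand≤supply inv) }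

  module _ (M : PartialMatching K) (inv : Invariant M) {x : Fin n} (¬univ-x : ¬ Universal K x)
           (x-free : free M x ≡ true) (alone : ∀ y → y ≢ x → (inClique x y ∧ free M y) ≡ false) where

    lonely : ∀ {z} → InClique x z → freeInClique M z ≡ 1
    lonely {z} x~z = begin
      sum (λ y → ⟦ inClique z y ∧ free M y ⟧)
        ≡⟨ sum-cong-≗ (λ y → cong (λ c → ⟦ c ∧ free M y ⟧) (inClique-same ¬univ-x x~z y)) ⟨
      sum (λ y → ⟦ inClique x y ∧ free M y ⟧)
        ≡⟨ sum-single _ x (λ y y≢x → cong ⟦_⟧ (alone y y≢x)) ⟩
      ⟦ inClique x x ∧ free M x ⟧
        ≡⟨ cong ⟦_⟧ (cong₂ _∧_ (dec-true (InClique? x x) (clique-self ¬univ-x)) x-free) ⟩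
      1
        ∎
      where open ≡-Reasoning

    edgesToU≥3 : 3 ≤ cliqueEdgesToU x
    edgesToU≥3 =
      odd-clique⇒edgesToU≥3 ¬univ-x (odd-free⇒odd-clique inv ¬univ-x (cong odd (lonely (clique-self ¬univ-x))))

    edgesToU≤demand : cliqueEdgesToU x ≤ demand M
    edgesToU≤demand = sum-mono-≤ term
      where
      term : ∀ z → ⟦ inClique x z ⟧ * edgesToU z ≤ ⟦ inW z ∧ odd (freeInClique M z) ⟧ * edgesToU z
      term z with inClique x z in x~z?
      ... | false = z≤n
      ... | true  rewrite inW-true (proj₁ (does-true⇒ (InClique? x z) x~z?))
                        | lonely (does-true⇒ (InClique? x z) x~z?) = ≤-refl

    0<freeU : 0 < freeU M
    0<freeU = *-cancelˡ-< 3 0 (freeU M) (begin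
      1                  ≤⟨ s≤s z≤n ⟩
      3                  ≤⟨ edgesToU≥3 ⟩
      cliqueEdgesToU x   ≤⟨ edgesToU≤demand ⟩
      demand M           ≤⟨ demand≤supply inv ⟩
      3 * freeU M        ∎)
      where open ≤-Reasoning

    free-universal : ∃ λ u → Universal K u × free M u ≡ true
    free-universal with sum-pos (λ u → ⟦ inU u ∧ free M u ⟧) 0<freeU
    ... | u , 0<term with ∧≡true (0<⟦⟧⇒true 0<term)
    ...   | u∈U , u-free = u , does-true⇒ (Universal? K u) u∈U , u-free

    match-lonely-with : ∀ {u} → Universal K u → free M u ≡ true → Improvement M
    match-lonely-with {u} univ-u u-free = M' , invariant , fewer-free
      where
      x≢u : x ≢ u
      x≢u refl = ¬univ-x univ-u
      open Matched M inv x≢u x-free u-free (adj-sym K (univ-u x x≢u))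
      split : ∀ z → freeInClique M z ≡ freeInClique M' z + ⟦ inClique z x ⟧
      split z = trans (freeInClique-matchPair z)
                      (cong (freeInClique M' z +_) (trans (cong (λ c → ⟦ inClique z x ⟧ + ⟦ c ⟧) (universal-outside univ-u))
                                                          (+-identityʳ ⟦ inClique z x ⟧)))
      cleared : ∀ {z} → InClique x z → freeInClique M' z ≡ 0
      cleared {z} x~z = +-cancelʳ-≡ 1 (freeInClique M' z) 0 (begin
        freeInClique M' z + 1
          ≡⟨ cong (λ c → freeInClique M' z + ⟦ c ⟧) (dec-true (InClique? z x) (clique-sym ¬univ-x x~z)) ⟨
        freeInClique M' z + ⟦ inClique z x ⟧    ≡⟨ split z ⟨
        freeInClique M z                        ≡⟨ lonely x~z ⟩
        1                                       ∎)
        where open ≡-Reasoning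
      untouched : ∀ {z} → ¬ InClique z x → freeInClique M' z ≡ freeInClique M z
      untouched {z} ¬z~x = sym (trans (split z) (trans (cong (λ c → freeInClique M' z + ⟦ c ⟧) (dec-false (InClique? z x) ¬z~x))
                                                        (+-identityʳ (freeInClique M' z))))
      demand-split : demand M ≡ demand M' + cliqueEdgesToU x
      demand-split = trans (sum-cong-≗ term) (∑-distrib-+ (λ z → ⟦ inW z ∧ odd (freeInClique M' z) ⟧ * edgesToU z) _)
        where
        term : ∀ z → ⟦ inW z ∧ odd (freeInClique M z) ⟧ * edgesToU z ≡
                     ⟦ inW z ∧ odd (freeInClique M' z) ⟧ * edgesToU z + ⟦ inClique x z ⟧ * edgesToU z
        term z with inClique x z in x~z?
        ... | true rewrite inW-true (proj₁ (does-true⇒ (InClique? x z) x~z?))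
                         | lonely (does-true⇒ (InClique? x z) x~z?) | cleared (does-true⇒ (InClique? x z) x~z?) = refl
        ... | false with Universal? K z
        ...   | yes univ  rewrite inW-false univ = refl
        ...   | no  ¬univ rewrite untouched (does-false⇒ (InClique? x z) x~z? ∘ clique-sym ¬univ) = sym (+-identityʳ _)
      freeU-split : freeU M ≡ freeU M' + 1
      freeU-split = trans freeU-matchPair (cong₂ (λ a b → freeU M' + (a + b)) (not-in-U ¬univ-x) (in-U univ-u))
      invariant : Invariant M'
      invariant = record
        { even-free = even-free'
        ; odd-free⇒odd-clique = odd-free⇒odd-clique'
        ; demand≤supply = +-cancelʳ-≤ 3 (demand M') (3 * freeU M') (begin
            demand M' + 3                  ≤⟨ +-monoʳ-≤ (demand M') edgesToU≥3 ⟩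
            demand M' + cliqueEdgesToU x   ≡⟨ demand-split ⟨
            demand M                       ≤⟨ demand≤supply inv ⟩
            3 * freeU M                    ≡⟨ cong (3 *_) freeU-split ⟩
            3 * (freeU M' + 1)             ≡⟨ *-distribˡ-+ 3 (freeU M') 1 ⟩
            3 * freeU M' + 3               ∎) }
        where
        open ≤-Reasoning
        odd-free⇒odd-clique' : ∀ {z} → ¬ Universal K z → odd (freeInClique M' z) ≡ true → odd (cliqueSize z) ≡ true
        odd-free⇒odd-clique' {z} ¬univ odd-free with InClique? x z
        ... | yes x~z with () ← trans (sym odd-free) (cong odd (cleared x~z))
        ... | no ¬x~z =
          odd-free⇒odd-clique inv ¬univ (trans (cong odd (sym (untouched (¬x~z ∘ clique-sym ¬univ)))) odd-free)

    match-lonely : Improvement M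
    match-lonely = let _ , univ-u , u-free = free-universal in match-lonely-with univ-u u-free

  match-universals : ∀ M → Invariant M → (∀ {z} → free M z ≡ true → Universal K z) →
                     ∀ {x} → free M x ≡ true → Improvement M
  match-universals M inv all-U {x} x-free with FP.any? (λ y → ¬? (y FP.≟ x) ×-dec (free M y BP.≟ true))
  ... | no no-other = ⊥-elim (false≢true (trans (sym (even-free inv)) (cong odd one-free)))
    where
    false≢true : false ≢ true
    false≢true ()
    one-free : freeCount M ≡ 1
    one-free = trans (sum-single _ x λ y y≢x → cong ⟦_⟧ (BP.¬-not λ y-free → no-other (y , y≢x , y-free)))
                     (cong ⟦_⟧ x-free)
  ... | yes (y , y≢x , y-free) = M' , invariant , fewer-free
    where
    open Matched M inv (y≢x ∘ sym) x-free y-free (all-U x-free y y≢x)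
    no-free-in-cliques : ∀ z → freeInClique M' z ≡ 0
    no-free-in-cliques z = sum-zero term
      where
      term : ∀ w → ⟦ inClique z w ∧ free M' w ⟧ ≡ 0
      term w with free M' w in w-free
      ... | false = cong ⟦_⟧ (BP.∧-zeroʳ (inClique z w))
      ... | true = cong (λ c → ⟦ c ∧ true ⟧)
                        (universal-outside (all-U (free-matchPair⇒free M (y≢x ∘ sym) x-free y-free (all-U x-free y y≢x) w-free)))
    invariant : Invariant M'
    invariant = record
      { even-free = even-free'
      ; odd-free⇒odd-clique = λ {z} _ odd-free → ⊥-elim (case (trans (sym odd-free) (cong odd (no-free-in-cliques z))))
      ; demand≤supply = subst (_≤ 3 * freeU M') (sym (sum-zero term)) z≤n }
      where
      case : true ≢ false
      case ()
      term : ∀ z → ⟦ inW z ∧ odd (freeInClique M' z) ⟧ * edgesToU z ≡ 0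
      term z rewrite no-free-in-cliques z | BP.∧-zeroʳ (inW z) = refl

  improve : ∀ M → Invariant M → (∀ x → free M x ≡ false) ⊎ Improvement M
  improve M inv with FP.any? (λ x → ¬? (Universal? K x) ×-dec (free M x BP.≟ true))
  ... | yes (x , ¬univ , x-free) with FP.any? (λ y → ¬? (y FP.≟ x) ×-dec (InClique? x y ×-dec (free M y BP.≟ true)))
  ...   | yes (y , y≢x , x~y , y-free) = inj₂ (match-in-clique M inv ¬univ (y≢x ∘ sym) x-free y-free x~y)
  ...   | no  alone = inj₂ (match-lonely M inv ¬univ x-free λ y y≢x → BP.¬-not λ both →
          let x~y , y-free = ∧≡true both in alone (y , y≢x , does-true⇒ (InClique? x y) x~y , y-free))
  improve M inv | no no-free-W with FP.any? (λ x → free M x BP.≟ true)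
  ... | yes (x , x-free) = inj₂ (match-universals M inv all-U x-free)
    where
    all-U : ∀ {z} → free M z ≡ true → Universal K z
    all-U {z} z-free = decidable-stable (Universal? K z) λ ¬univ → no-free-W (z , ¬univ , z-free)
  ... | no none-free = inj₁ λ x → BP.¬-not λ x-free → none-free (x , x-free)

  greedy : ∀ M → Invariant M → PerfectMatching K
  greedy = All.wfRec (On.wellFounded freeCount <-wellFounded) 0ℓ (λ M → Invariant M → PerfectMatching K) step
    where
    step : ∀ M → (∀ {M'} → freeCount M' < freeCount M → Invariant M' → PerfectMatching K) →
           Invariant M → PerfectMatching K
    step M recurse inv with improve M inv
    ... | inj₁ none-free         = perfect M none-free
    ... | inj₂ (M' , inv' , M'<M) = recurse M'<M inv'

  private
    M₀ : PartialMatching K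
    M₀ = emptyMatching K

    all-free : ∀ (c : Fin n → Bool) z → ⟦ c z ∧ free M₀ z ⟧ ≡ ⟦ c z ⟧
    all-free c z = cong ⟦_⟧ (trans (cong (c z ∧_) (≟ᵇ-refl z)) (BP.∧-identityʳ (c z)))

  initial : Invariant M₀
  initial = record
    { even-free = trans (cong odd freeCount≡n) (cubic⇒even-order G cubic)
    ; odd-free⇒odd-clique = λ {x} _ odd-free → trans (cong odd (sym (sum-cong-≗ (all-free (inClique x))))) odd-free
    ; demand≤supply = begin
        demand M₀
          ≤⟨ sum-mono-≤ (λ x → *-monoˡ-≤ (edgesToU x) (⟦⟧≤1 (inW x ∧ odd (freeInClique M₀ x)))) ⟩
        sum (λ x → 1 * edgesToU x)                      ≡⟨ sum-cong-≗ (λ x → *-identityˡ (edgesToU x)) ⟩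
        sum (λ x → sum λ u → ⟦ inU u ∧ adj G x u ⟧)     ≡⟨ ∑-comm (λ x u → ⟦ inU u ∧ adj G x u ⟧) ⟩
        sum (λ u → sum λ x → ⟦ inU u ∧ adj G x u ⟧)     ≡⟨ sum-cong-≗ degree-of-U ⟩
        sum (λ u → 3 * ⟦ inU u ⟧)                       ≡⟨ *-distribˡ-sum 3 (λ u → ⟦ inU u ⟧) ⟨
        3 * sum (λ u → ⟦ inU u ⟧)                       ≡⟨ cong (3 *_) (sum-cong-≗ (all-free inU)) ⟨
        3 * freeU M₀                                    ∎ }
    where
    freeCount≡n : freeCount M₀ ≡ n
    freeCount≡n = trans (sum-cong-≗ (all-free (λ _ → true))) (trans (sum-const n 1) (*-identityʳ n))
    degree-of-U : ∀ u → sum (λ x → ⟦ inU u ∧ adj G x u ⟧) ≡ 3 * ⟦ inU u ⟧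
    degree-of-U u = begin
      sum (λ x → ⟦ inU u ∧ adj G x u ⟧)
        ≡⟨ sum-cong-≗ (λ x → trans (cong (λ e → ⟦ inU u ∧ e ⟧) (SimpleGraph.sym G x u)) (⟦∧⟧ (inU u) (adj G u x))) ⟩
      sum (λ x → ⟦ inU u ⟧ * ⟦ adj G u x ⟧) ≡⟨ *-distribˡ-sum ⟦ inU u ⟧ (λ x → ⟦ adj G u x ⟧) ⟨
      ⟦ inU u ⟧ * sum (λ x → ⟦ adj G u x ⟧) ≡⟨ cong (⟦ inU u ⟧ *_) (degree≡3 u) ⟩
      ⟦ inU u ⟧ * 3                         ≡⟨ *-comm ⟦ inU u ⟧ 3 ⟩
      3 * ⟦ inU u ⟧                         ∎
      where open ≡-Reasoning
    open ≤-Reasoning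

  perfectMatching : PerfectMatching K
  perfectMatching = greedy M₀ initial

-- The colour-line representation

SamePair : ∀ {A : Set} → A → A → A → A → Set
SamePair p q r s = (p ≡ r × q ≡ s) ⊎ (p ≡ s × q ≡ r)

module _ {A : Set} {p q r s : A} where

  samePair-swap : SamePair p q r s → SamePair q p r s
  samePair-swap (inj₁ (p≡r , q≡s)) = inj₂ (q≡s , p≡r)
  samePair-swap (inj₂ (p≡s , q≡r)) = inj₁ (q≡r , p≡s)

  samePair-sym : SamePair p q r s → SamePair r s p q
  samePair-sym (inj₁ (p≡r , q≡s)) = inj₁ (sym p≡r , sym q≡s)
  samePair-sym (inj₂ (p≡s , q≡r)) = inj₂ (sym q≡r , sym p≡s)

samePair-trans : ∀ {A : Set} {p q r s t u : A} → SamePair p q r s → SamePair r s t u → SamePair p q t u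
samePair-trans (inj₁ (refl , refl)) rs~tu = rs~tu
samePair-trans (inj₂ (refl , refl)) rs~tu = samePair-swap rs~tu

pairCode : ∀ {n} → Fin n → Fin n → Fin (n * n)
pairCode p q with p FP.≤? q
... | yes _ = combine p q
... | no  _ = combine q p

pairCode-sym : ∀ {n} (p q : Fin n) → pairCode p q ≡ pairCode q p
pairCode-sym p q with p FP.≤? q | q FP.≤? p
... | yes p≤q | yes q≤p = cong₂ combine (FP.≤-antisym p≤q q≤p) (FP.≤-antisym q≤p p≤q)
... | yes _   | no _    = refl
... | no _    | yes _   = refl
... | no p≰q  | no q≰p  = ⊥-elim (p≰q (≰⇒≥ q≰p))

pairCode-injective : ∀ {n} (p q r s : Fin n) → pairCode p q ≡ pairCode r s → SamePair p q r s
pairCode-injective p q r s eq with p FP.≤? q | r FP.≤? s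
... | yes _ | yes _ = inj₁ (FP.combine-injective p q r s eq)
... | yes _ | no  _ = inj₂ (FP.combine-injective p q s r eq)
... | no  _ | yes _ = samePair-swap (inj₁ (FP.combine-injective q p r s eq))
... | no  _ | no  _ = samePair-swap (inj₂ (FP.combine-injective q p s r eq))

record SortedPair {N} (a b : Fin N) : Set where
  field
    lo hi  : Fin N
    lo<hi  : lo Data.Fin.< hi
    sorted : SamePair lo hi a b

sortPair : ∀ {N} {a b : Fin N} → a ≢ b → SortedPair a b
sortPair {a = a} {b} a≢b with FP.<-cmp a b
... | tri< a<b _ _ = record { lo = a ; hi = b ; lo<hi = a<b ; sorted = inj₁ (refl , refl) }
... | tri≈ _ a≡b _ = ⊥-elim (a≢b a≡b)
... | tri> _ _ b<a = record { lo = b ; hi = a ; lo<hi = b<a ; sorted = inj₂ (refl , refl) }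

-- The vertices of H are codes of unordered pairs of vertices of G.  The vertex x of G
-- becomes the H-edge σ x between the codes of its two edges in the 2-factor G − M, and is
-- coloured by the code of its edge in M.
module ColorLine {n} (G : SimpleGraph n) (cubic : Cubic G) (M : PerfectMatching G) where
  open PerfectMatching M

  opaque
    others : ∀ x → TwoOthers (adj G x) (mate x)
    others x = count≡3⇒twoOthers (adj G x) (adj-mate x) (cubic⇒degree≡3 G cubic x)

  open module Others x = TwoOthers (others x) using (y₁; y₂)

  TwoFactor : Fin n → Fin n → Set
  TwoFactor x y = adj G x y ≡ true × y ≢ mate x

  twoFactor-sym : ∀ {x y} → TwoFactor x y → TwoFactor y x
  twoFactor-sym (xy , y≢mx) = adj-sym G xy , λ x≡my → y≢mx (mate-unique x≡my)

  twoFactor-y₁ : ∀ x → TwoFactor x (y₁ x)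
  twoFactor-y₁ x = Others.P-y₁ x , Others.y₁≢x₀ x

  twoFactor-y₂ : ∀ x → TwoFactor x (y₂ x)
  twoFactor-y₂ x = Others.P-y₂ x , Others.y₂≢x₀ x

  twoFactor-cases : ∀ {x z} → TwoFactor x z → z ≡ y₁ x ⊎ z ≡ y₂ x
  twoFactor-cases {x} (xz , z≢mx) with Others.only x xz
  ... | inj₁ z≡mx    = ⊥-elim (z≢mx z≡mx)
  ... | inj₂ z∈y₁y₂  = z∈y₁y₂

  end₁ end₂ : Fin n → Fin (n * n)
  end₁ x = pairCode x (y₁ x)
  end₂ x = pairCode x (y₂ x)

  EndOf : Fin (n * n) → Fin n → Set
  EndOf c x = c ≡ end₁ x ⊎ c ≡ end₂ x

  endOf-own : ∀ {x y} → TwoFactor x y → EndOf (pairCode x y) x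
  endOf-own {x} xy with twoFactor-cases xy
  ... | inj₁ refl = inj₁ refl
  ... | inj₂ refl = inj₂ refl

  endOf-code : ∀ {x y x'} → EndOf (pairCode x y) x' → x' ≡ x ⊎ x' ≡ y
  endOf-code {x} {y} {x'} (inj₁ eq) with pairCode-injective x y x' (y₁ x') eq
  ... | inj₁ (x≡x' , _) = inj₁ (sym x≡x')
  ... | inj₂ (_ , y≡x') = inj₂ (sym y≡x')
  endOf-code {x} {y} {x'} (inj₂ eq) with pairCode-injective x y x' (y₂ x') eq
  ... | inj₁ (x≡x' , _) = inj₁ (sym x≡x')
  ... | inj₂ (_ , y≡x') = inj₂ (sym y≡x')

  end₁≢end₂ : ∀ x → end₁ x ≢ end₂ x
  end₁≢end₂ x eq with pairCode-injective x (y₁ x) x (y₂ x) eq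
  ... | inj₁ (_ , y₁≡y₂) = Others.y₁≢y₂ x y₁≡y₂
  ... | inj₂ (x≡y₂ , _)  = adj⇒≢ G (Others.P-y₂ x) x≡y₂

  ends-determine : ∀ {x x'} → SamePair (end₁ x) (end₂ x) (end₁ x') (end₂ x') → x ≡ x'
  ends-determine {x} {x'} same = sym (both (endOf-code (at₁ same)) (endOf-code (at₂ same)))
    where
    at₁ : SamePair (end₁ x) (end₂ x) (end₁ x') (end₂ x') → EndOf (end₁ x) x'
    at₁ (inj₁ (e , _)) = inj₁ e
    at₁ (inj₂ (e , _)) = inj₂ e
    at₂ : SamePair (end₁ x) (end₂ x) (end₁ x') (end₂ x') → EndOf (end₂ x) x'
    at₂ (inj₁ (_ , e)) = inj₂ e
    at₂ (inj₂ (_ , e)) = inj₁ e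
    both : x' ≡ x ⊎ x' ≡ y₁ x → x' ≡ x ⊎ x' ≡ y₂ x → x' ≡ x
    both (inj₁ x'≡x) _          = x'≡x
    both _          (inj₁ x'≡x) = x'≡x
    both (inj₂ x'≡y₁) (inj₂ x'≡y₂) = ⊥-elim (Others.y₁≢y₂ x (trans (sym x'≡y₁) x'≡y₂))

  Joins : Fin (n * n) → Fin (n * n) → Fin n → Set
  Joins c d x = SamePair c d (end₁ x) (end₂ x)

  Joins? : ∀ c d x → Dec (Joins c d x)
  Joins? c d x = ((c FP.≟ end₁ x) ×-dec (d FP.≟ end₂ x)) ⊎-dec ((c FP.≟ end₂ x) ×-dec (d FP.≟ end₁ x))

  joins-unique : ∀ {c d x x'} → Joins c d x → Joins c d x' → x ≡ x'
  joins-unique cd~x cd~x' = ends-determine (samePair-trans (samePair-sym cd~x) cd~x')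

  H : SimpleGraph (n * n)
  H = record
    { adj   = λ c d → does (FP.any? (Joins? c d))
    ; sym   = λ c d → does-⇔ (mk⇔ swap swap) (FP.any? (Joins? c d)) (FP.any? (Joins? d c))
    ; irref = λ c → dec-false (FP.any? (Joins? c c)) λ (x , cc~x) → end₁≢end₂ x (loop {x = x} cc~x) }
    where
    swap : ∀ {c d} → ∃ (Joins c d) → ∃ (Joins d c)
    swap (x , cd~x) = x , samePair-swap cd~x
    loop : ∀ {c x} → Joins c c x → end₁ x ≡ end₂ x
    loop (inj₁ (c≡e₁ , c≡e₂)) = trans (sym c≡e₁) c≡e₂
    loop (inj₂ (c≡e₂ , c≡e₁)) = trans (sym c≡e₁) c≡e₂

  adj-H : ∀ {c d x} → Joins c d x → adj H c d ≡ true
  adj-H {c} {d} {x} cd~x = dec-true (FP.any? (Joins? c d)) (x , cd~x)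

  adj-H⇒ : ∀ {c d} → adj H c d ≡ true → ∃ (Joins c d)
  adj-H⇒ {c} {d} = does-true⇒ (FP.any? (Joins? c d))

  opaque
    sorted : ∀ x → SortedPair (end₁ x) (end₂ x)
    sorted x = sortPair (end₁≢end₂ x)

  lo hi : Fin n → Fin (n * n)
  lo x = SortedPair.lo (sorted x)
  hi x = SortedPair.hi (sorted x)

  σ : Fin n → Edge H
  σ x = (lo x , hi x) , SortedPair.lo<hi (sorted x) , adj-H {x = x} (SortedPair.sorted (sorted x))

  edge-≡ : ∀ (e f : Edge H) → endpoints {H = H} e ≡ endpoints {H = H} f → e ≡ f
  edge-≡ (cd , c<d , cd∈H) (.cd , c<d' , cd∈H') refl =
    cong₂ (λ p q → cd , p , q) (FP.<-irrelevant c<d c<d') (UIP.Decidable⇒UIP.≡-irrelevant BP._≟_ cd∈H cd∈H')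

  σ-injective : ∀ {x y} → σ x ≡ σ y → x ≡ y
  σ-injective {x} {y} σx≡σy = joins-unique (SortedPair.sorted (sorted x))
    (subst (λ cd → Joins (proj₁ cd) (proj₂ cd) y) (sym (cong proj₁ σx≡σy)) (SortedPair.sorted (sorted y)))

  opaque
    σ-surjective : ∀ e → ∃ λ x → σ x ≡ e
    σ-surjective e@((c , d) , c<d , cd∈H) with adj-H⇒ cd∈H
    ... | x , cd~x = x , edge-≡ (σ x) e (cong₂ _,_ lo≡c hi≡d)
      where
      lohi~cd : SamePair (lo x) (hi x) c d
      lohi~cd = samePair-trans (SortedPair.sorted (sorted x)) (samePair-sym cd~x)
      lo≡c : lo x ≡ c
      lo≡c with lohi~cd
      ... | inj₁ (lo≡c , _)    = lo≡c
      ... | inj₂ (refl , refl) = ⊥-elim (FP.<-asym c<d (SortedPair.lo<hi (sorted x)))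
      hi≡d : hi x ≡ d
      hi≡d with lohi~cd
      ... | inj₁ (_ , hi≡d)    = hi≡d
      ... | inj₂ (refl , refl) = ⊥-elim (FP.<-asym c<d (SortedPair.lo<hi (sorted x)))

  σ-bijection : Fin n ⤖ Edge H
  σ-bijection = mk⤖ {to = σ} ((λ {x} {y} → σ-injective {x} {y}) , surjective)
    where
    surjective : ∀ e → ∃ λ x → ∀ {z} → z ≡ x → σ z ≡ e
    surjective e = proj₁ (σ-surjective e) , λ { refl → proj₂ (σ-surjective e) }

  colour : Fin n → ℕ
  colour x = toℕ (pairCode x (mate x))

  colour-mate : ∀ x → colour (mate x) ≡ colour x
  colour-mate x = cong toℕ (trans (cong (pairCode (mate x)) (mate-involutive x)) (pairCode-sym (mate x) x))

  colour-≡ : ∀ {v w} → colour v ≡ colour w → w ≡ v ⊎ w ≡ mate v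
  colour-≡ {v} {w} eq with pairCode-injective v (mate v) w (mate w) (FP.toℕ-injective eq)
  ... | inj₁ (v≡w , _)  = inj₁ (sym v≡w)
  ... | inj₂ (_ , mv≡w) = inj₂ (sym mv≡w)

  φ : Edge H → ℕ
  φ e = colour (proj₁ (σ-surjective e))

  φ-σ : ∀ x → φ (σ x) ≡ colour x
  φ-σ x = cong colour (σ-injective {proj₁ (σ-surjective (σ x))} {x} (proj₂ (σ-surjective (σ x))))

  endOf⇒lo/hi : ∀ {c x} → EndOf c x → c ≡ lo x ⊎ c ≡ hi x
  endOf⇒lo/hi {c} {x} c∈x with SortedPair.sorted (sorted x) | c∈x
  ... | inj₁ (lo≡e₁ , _) | inj₁ c≡e₁ = inj₁ (trans c≡e₁ (sym lo≡e₁))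
  ... | inj₁ (_ , hi≡e₂) | inj₂ c≡e₂ = inj₂ (trans c≡e₂ (sym hi≡e₂))
  ... | inj₂ (_ , hi≡e₁) | inj₁ c≡e₁ = inj₂ (trans c≡e₁ (sym hi≡e₁))
  ... | inj₂ (lo≡e₂ , _) | inj₂ c≡e₂ = inj₁ (trans c≡e₂ (sym lo≡e₂))

  lo-endOf : ∀ x → EndOf (lo x) x
  lo-endOf x with SortedPair.sorted (sorted x)
  ... | inj₁ (lo≡e₁ , _) = inj₁ lo≡e₁
  ... | inj₂ (lo≡e₂ , _) = inj₂ lo≡e₂

  hi-endOf : ∀ x → EndOf (hi x) x
  hi-endOf x with SortedPair.sorted (sorted x)
  ... | inj₁ (_ , hi≡e₂) = inj₂ hi≡e₂
  ... | inj₂ (_ , hi≡e₁) = inj₁ hi≡e₁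

  shareEnd⇒common : ∀ {i j} → ShareEnd {H = H} (σ i) (σ j) → ∃ λ c → EndOf c i × EndOf c j
  shareEnd⇒common {i} {j} (inj₁ (inj₁ lo≡lo)) = lo i , lo-endOf i , subst (λ c → EndOf c j) (sym lo≡lo) (lo-endOf j)
  shareEnd⇒common {i} {j} (inj₁ (inj₂ lo≡hi)) = lo i , lo-endOf i , subst (λ c → EndOf c j) (sym lo≡hi) (hi-endOf j)
  shareEnd⇒common {i} {j} (inj₂ (inj₁ hi≡lo)) = hi i , hi-endOf i , subst (λ c → EndOf c j) (sym hi≡lo) (lo-endOf j)
  shareEnd⇒common {i} {j} (inj₂ (inj₂ hi≡hi)) = hi i , hi-endOf i , subst (λ c → EndOf c j) (sym hi≡hi) (hi-endOf j)

  common⇒shareEnd : ∀ {i j c} → EndOf c i → EndOf c j → ShareEnd {H = H} (σ i) (σ j)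
  common⇒shareEnd {i} {j} {c} c∈i c∈j with endOf⇒lo/hi {c} {i} c∈i | endOf⇒lo/hi {c} {j} c∈j
  ... | inj₁ c≡lo | inj₁ c≡lo' = inj₁ (inj₁ (trans (sym c≡lo) c≡lo'))
  ... | inj₁ c≡lo | inj₂ c≡hi' = inj₁ (inj₂ (trans (sym c≡lo) c≡hi'))
  ... | inj₂ c≡hi | inj₁ c≡lo' = inj₂ (inj₁ (trans (sym c≡hi) c≡lo'))
  ... | inj₂ c≡hi | inj₂ c≡hi' = inj₂ (inj₂ (trans (sym c≡hi) c≡hi'))

  shareEnd⇒twoFactor : ∀ {i j} → i ≢ j → ShareEnd {H = H} (σ i) (σ j) → TwoFactor i j
  shareEnd⇒twoFactor {i} {j} i≢j share with shareEnd⇒common {i} {j} share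
  ... | c , inj₁ refl , c∈j = via (twoFactor-y₁ i) (endOf-code c∈j)
    where
    via : ∀ {y} → TwoFactor i y → j ≡ i ⊎ j ≡ y → TwoFactor i j
    via _  (inj₁ j≡i) = ⊥-elim (i≢j (sym j≡i))
    via iy (inj₂ refl) = iy
  ... | c , inj₂ refl , c∈j = via (twoFactor-y₂ i) (endOf-code c∈j)
    where
    via : ∀ {y} → TwoFactor i y → j ≡ i ⊎ j ≡ y → TwoFactor i j
    via _  (inj₁ j≡i) = ⊥-elim (i≢j (sym j≡i))
    via iy (inj₂ refl) = iy

  twoFactor⇒shareEnd : ∀ {i j} → TwoFactor i j → ShareEnd {H = H} (σ i) (σ j)
  twoFactor⇒shareEnd {i} {j} ij = common⇒shareEnd {i} {j} {pairCode i j} (endOf-own ij)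
    (subst (λ c → EndOf c j) (pairCode-sym j i) (endOf-own (twoFactor-sym ij)))

  distinct : ∀ {i j} → i ≢ j → DistinctEdges {H = H} (σ i) (σ j)
  distinct {i} {j} i≢j same = i≢j (σ-injective {i} {j} (edge-≡ (σ i) (σ j) same))

  distinct⇒≢ : ∀ {i j} → DistinctEdges {H = H} (σ i) (σ j) → i ≢ j
  distinct⇒≢ σi≢σj refl = σi≢σj refl

  colourLine-adj : ∀ i j → (adj G i j ≡ true) ⇔ CLAdj H φ (σ i) (σ j)
  colourLine-adj i j = mk⇔ to from
    where
    to : adj G i j ≡ true → CLAdj H φ (σ i) (σ j)
    to ij = distinct {i} {j} (adj⇒≢ G ij) , by-mate (j FP.≟ mate i)
      where
      by-mate : Dec (j ≡ mate i) → ShareEnd {H = H} (σ i) (σ j) ⊎ φ (σ i) ≡ φ (σ j)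
      by-mate (yes refl) = inj₂ (trans (φ-σ i) (trans (sym (colour-mate i)) (sym (φ-σ (mate i)))))
      by-mate (no  j≢mi) = inj₁ (twoFactor⇒shareEnd {i} {j} (ij , j≢mi))
    from : CLAdj H φ (σ i) (σ j) → adj G i j ≡ true
    from (σi≢σj , inj₁ share) = proj₁ (shareEnd⇒twoFactor {i} {j} (distinct⇒≢ {i} {j} σi≢σj) share)
    from (σi≢σj , inj₂ same) = by-colour (colour-≡ {i} {j} (trans (sym (φ-σ i)) (trans same (φ-σ j))))
      where
      by-colour : j ≡ i ⊎ j ≡ mate i → adj G i j ≡ true
      by-colour (inj₁ j≡i)  = ⊥-elim (distinct⇒≢ {i} {j} σi≢σj (sym j≡i))
      by-colour (inj₂ j≡mi) = subst (λ y → adj G i y ≡ true) (sym j≡mi) (adj-mate i)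

  proper-σ : ∀ i j → DistinctEdges {H = H} (σ i) (σ j) → ShareEnd {H = H} (σ i) (σ j) → φ (σ i) ≢ φ (σ j)
  proper-σ i j σi≢σj share same = by-colour (colour-≡ {i} {j} (trans (sym (φ-σ i)) (trans same (φ-σ j))))
    where
    by-colour : j ≡ i ⊎ j ≡ mate i → ⊥
    by-colour (inj₁ j≡i)  = distinct⇒≢ {i} {j} σi≢σj (sym j≡i)
    by-colour (inj₂ j≡mi) = proj₂ (shareEnd⇒twoFactor {i} {j} (distinct⇒≢ {i} {j} σi≢σj) share) j≡mi

  proper : ProperColoring H φ
  proper e f = transport (σ-surjective e) (σ-surjective f)
    where
    transport : (∃ λ i → σ i ≡ e) → (∃ λ j → σ j ≡ f) →
                DistinctEdges {H = H} e f → ShareEnd {H = H} e f → φ e ≢ φ f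
    transport (i , σi≡e) (j , σj≡f) =
      subst₂ (λ e f → DistinctEdges {H = H} e f → ShareEnd {H = H} e f → φ e ≢ φ f) σi≡e σj≡f (proper-σ i j)

  isProperColorLineGraph : IsProperColorLineGraph G
  isProperColorLineGraph = n * n , H , φ , proper , σ-bijection , colourLine-adj

petersen : ∀ {n} (G : SimpleGraph n) → Cubic G → Bridgeless G → PerfectMatching G
petersen G cubic bridgeless =
  Saturation.perfectMatching-⊇ G (Greedy.perfectMatching G cubic bridgeless) G (λ _ _ xy∈G → xy∈G)

corollary1 : ∀ (n : ℕ) (G : SimpleGraph n) → Cubic G → Bridgeless G → IsProperColorLineGraph G
corollary1 n G cubic bridgeless = ColorLine.isProperColorLineGraph G cubic (petersen G cubic bridgeless)
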